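{- The groups of orders $29$, $37$ and $41$ (i.e. the cyclic groups $C_{29}$, $C_{37}$, $C_{41}$) are not DS.
   Context: For a finite group $G$ and a subset $S\subseteq G\setminus\{1\}$ with $S=S^{ -1}$, the Cayley graph $Cay(G,S)$ has vertex set $G$, with $a,b$ adjacent iff $ab^{ -1}\in S$. The spectrum of a graph is the multiset of eigenvalues of its adjacency matrix. A finite group $G$ is DS if every Cayley graph $\Gamma$ on $G$ is isomorphic to every (finite simple) graph $\Gamma'$ with the same spectrum as $\Gamma$. -}

module Defs where

open import Data.Bool using (Bool; true; false; if_then_else_)
open import Data.Nat as ℕ using (ℕ; zero; suc; NonZero)
open import Data.Nat.DivMod using (_mod_)
open import Data.Fin using (Fin; zero; suc; toℕ; punchIn)
open import Data.Integer as ℤ using (ℤ; 0ℤ; 1ℤ; -1ℤ)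
open import Data.List using (List; []; _∷_)
open import Data.Product using (Σ; _×_)
open import Function.Bundles using (_↔_; Inverse)
open import Relation.Binary.PropositionalEquality using (_≡_)
open import Relation.Nullary using (does)

Adj : ℕ → Set
Adj n = Fin n → Fin n → Bool

IsSimple : ∀ {n} → Adj n → Set
IsSimple {n} A = (∀ i j → A i j ≡ A j i) × (∀ i → A i i ≡ false)

record Graph (n : ℕ) : Set where
  field
    adj    : Adj n
    simple : IsSimple adj
open Graph public

Isomorphic : ∀ {n m} → Adj n → Adj m → Set
Isomorphic {n} {m} A B =
  Σ (Fin n ↔ Fin m) λ f →
    ∀ i j → A i j ≡ B (Inverse.to f i) (Inverse.to f j)

-- Integer polynomials as coefficient lists (constant term first)

Poly : Set
Poly = List ℤ

infixl 6 _+ₚ_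
infixl 7 _*ₚ_

_+ₚ_ : Poly → Poly → Poly
[] +ₚ q = q
(a ∷ p) +ₚ [] = a ∷ p
(a ∷ p) +ₚ (b ∷ q) = (a ℤ.+ b) ∷ (p +ₚ q)

scaleₚ : ℤ → Poly → Poly
scaleₚ c [] = []
scaleₚ c (a ∷ p) = (c ℤ.* a) ∷ scaleₚ c p

_*ₚ_ : Poly → Poly → Poly
[] *ₚ q = []
(a ∷ p) *ₚ q = scaleₚ a q +ₚ (0ℤ ∷ (p *ₚ q))

-ₚ_ : Poly → Poly
-ₚ p = scaleₚ -1ℤ p

normₚ : Poly → Poly
normₚ [] = []
normₚ (a ∷ p) with normₚ p
... | [] = if does (a ℤ.≟ 0ℤ) then [] else a ∷ []
... | b ∷ q = a ∷ b ∷ q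

_≈ₚ_ : Poly → Poly → Set
p ≈ₚ q = normₚ p ≡ normₚ q

sumFin : ∀ {n} → (Fin n → Poly) → Poly
sumFin {zero} f = []
sumFin {suc n} f = f zero +ₚ sumFin (λ j → f (suc j))

signFin : ∀ {n} → Fin n → ℤ
signFin zero = 1ℤ
signFin (suc j) = ℤ.- signFin j

det : ∀ n → (Fin n → Fin n → Poly) → Poly
det zero M = 1ℤ ∷ []
det (suc n) M =
  sumFin λ j → scaleₚ (signFin j)
    (M zero j *ₚ det n (λ r c → M (suc r) (punchIn j c)))

adjMatrix : ∀ {n} → Adj n → Fin n → Fin n → ℤ
adjMatrix A i j = if A i j then 1ℤ else 0ℤ

X : Poly
X = 0ℤ ∷ 1ℤ ∷ []

δ : ∀ {n} → Fin n → Fin n → Poly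
δ zero zero = 1ℤ ∷ []
δ zero (suc j) = []
δ (suc i) zero = []
δ (suc i) (suc j) = δ i j

charPoly : ∀ {n} → Adj n → Poly
charPoly {n} A = det n λ i j → (X *ₚ δ i j) +ₚ (-ₚ (adjMatrix A i j ∷ []))

-- Same spectrum (multiset of eigenvalues over ℂ) ⇔ same characteristic
-- polynomial, as the char. poly. is monic and splits over ℂ.
Cospectral : ∀ {n m} → Adj n → Adj m → Set
Cospectral A B = charPoly A ≈ₚ charPoly B

-- Cayley graphs on the cyclic group ℤ/nℤ (elements Fin n, addition mod n)

module _ (n : ℕ) .{{_ : NonZero n}} where

  zeroG : Fin n
  zeroG = 0 mod n

  invG : Fin n → Fin n
  invG b = (n ℕ.∸ toℕ b) mod n

  subG : Fin n → Fin n → Fin n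
  subG a b = (toℕ a ℕ.+ (n ℕ.∸ toℕ b)) mod n

  record ConnSet : Set where
    field
      mem       : Fin n → Bool
      noIdent   : mem zeroG ≡ false
      inverseCl : ∀ x → mem (invG x) ≡ mem x
  open ConnSet public

  Cay : ConnSet → Adj n
  Cay S a b = mem S (subG a b)

  IsDS : Set
  IsDS = (S : ConnSet) → (m : ℕ) → (Γ : Graph m) →
         Cospectral (Cay S) (adj Γ) → Isomorphic (Cay S) (adj Γ)

{-# OPTIONS --safe #-}
-- The Paley graph P(p) = Cay(ℤ/p, nonzero squares) is strongly regular, and for p = 29, 37, 41 there is
-- another strongly regular graph Γ with the same parameters, hence with the same spectrum.  Equality of
-- the characteristic polynomials is certified by evaluating both at p + 1 integers: each value
-- det(tI − A) is computed by Bareiss' fraction-free elimination, proved correct against the Laplace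
-- expansion, and two polynomials of degree ≤ p that agree at p + 1 points are equal.  Γ is not
-- isomorphic to P(p) because it contains an induced subgraph (K₅, or K₆ minus an edge for p = 41) that
-- P(p) lacks; as Cayley graphs are vertex-transitive, P(p) only has to be searched around the vertex 0.
module Submission where

open import Data.Nat using (ℕ; zero; suc; NonZero)
open import Data.Product using (_×_; _,_)
open import Relation.Binary.PropositionalEquality
open import Relation.Nullary using (¬_)
open import Defs

module Determinant where

  open import Data.Bool using (Bool; if_then_else_)
  open import Data.Empty using (⊥-elim)
  open import Data.Fin as Fin using (Fin; zero; suc; punchIn; lift; toℕ; fromℕ<)
  open import Data.Fin.Properties using (suc-injective; toℕ-injective; toℕ-fromℕ<; toℕ<n)
  open import Data.Integer as ℤ using (ℤ; 0ℤ; 1ℤ; -1ℤ; _+_; _*_; -_; _-_; _^_)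
  open import Data.Integer.Properties using (+-*-semiring; neg-distrib-+; i*j≢0)
  open import Algebra.Properties.Semiring.Sum +-*-semiring
    using (sum; sum-cong-≗; ∑-distrib-+; *-distribˡ-sum; sum-replicate-zero)
  open import Data.Integer.Tactic.RingSolver using (solve-∀)
  open import Data.Nat as ℕ using (_<?_)
  import Data.Nat.Properties as ℕ
  open import Data.Vec.Functional using (updateAt; tail)
  open import Data.Vec.Functional.Properties using (updateAt-updates; updateAt-minimal)
  open import Function using (_∘_; const; case_of_)
  open import Relation.Nullary using (Dec; does; yes; no)
  open import Relation.Nullary.Decidable using (dec-true; dec-false)
  open ≡-Reasoning

  private variable
    k n : ℕ

  sum-linear : ∀ {f : Fin n → ℤ} (a b : ℤ) (g h : Fin n → ℤ) →
    (∀ j → f j ≡ a * g j + b * h j) → sum f ≡ a * sum g + b * sum h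
  sum-linear {f = f} a b g h eq = begin
    sum f                                      ≡⟨ sum-cong-≗ eq ⟩
    sum (λ j → a * g j + b * h j)              ≡⟨ ∑-distrib-+ (λ j → a * g j) (λ j → b * h j) ⟩
    sum (λ j → a * g j) + sum (λ j → b * h j)  ≡⟨ cong₂ _+_ (*-distribˡ-sum a g) (*-distribˡ-sum b h) ⟨
    a * sum g + b * sum h                      ∎

  sum-neg : (f : Fin n → ℤ) → sum (λ j → - f j) ≡ - sum f
  sum-neg {zero}  f = refl
  sum-neg {suc n} f = begin
    - f zero + sum (λ j → - f (suc j))  ≡⟨ cong (- f zero +_) (sum-neg (f ∘ suc)) ⟩
    - f zero + - sum (f ∘ suc)          ≡⟨ neg-distrib-+ (f zero) (sum (f ∘ suc)) ⟨
    - sum f                             ∎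

  sum-zero : {f : Fin n → ℤ} → (∀ j → f j ≡ 0ℤ) → sum f ≡ 0ℤ
  sum-zero {n} eq = trans (sum-cong-≗ eq) (sum-replicate-zero n)

  ^-nonZero : ∀ a n .{{_ : ℤ.NonZero a}} → ℤ.NonZero (a ^ n)
  ^-nonZero a zero    = _
  ^-nonZero a (suc n) = i*j≢0 a (a ^ n)
    where instance
    aⁿ≢0 : ℤ.NonZero (a ^ n)
    aⁿ≢0 = ^-nonZero a n

  x≡-x⇒x≡0 : ∀ {x} → x ≡ - x → x ≡ 0ℤ
  x≡-x⇒x≡0 {ℤ.+ zero} _ = refl

  Matrix : ℕ → Set
  Matrix n = Fin n → Fin n → ℤ

  minor : Matrix (suc n) → Fin (suc n) → Matrix n
  minor M j r c = M (suc r) (punchIn j c)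

  detℤ : Matrix n → ℤ
  laplaceTerm : Matrix (suc n) → Fin (suc n) → ℤ

  detℤ {zero}  M = 1ℤ
  detℤ {suc n} M = sum (laplaceTerm M)

  laplaceTerm M j = signFin j * (M zero j * detℤ (minor M j))

  detℤ-cong : {M N : Matrix n} → (∀ i j → M i j ≡ N i j) → detℤ M ≡ detℤ N
  detℤ-cong {zero}  eq = refl
  detℤ-cong {suc n} eq = sum-cong-≗ λ j →
    cong₂ (λ x y → signFin j * (x * y)) (eq zero j) (detℤ-cong λ r c → eq (suc r) (punchIn j c))

  private
    linear-entry : ∀ a b s m₁ m₂ {m x x₁ x₂} → m ≡ a * m₁ + b * m₂ → x ≡ x₁ → x ≡ x₂ →
      s * (m * x) ≡ a * (s * (m₁ * x₁)) + b * (s * (m₂ * x₂))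
    linear-entry a b s m₁ m₂ {x = x} refl refl refl = ring a b s m₁ m₂ x
      where
      ring : ∀ a b s m₁ m₂ x → s * ((a * m₁ + b * m₂) * x) ≡ a * (s * (m₁ * x)) + b * (s * (m₂ * x))
      ring = solve-∀

    linear-cofactor : ∀ a b s m x₁ x₂ {m₁ m₂ x} → m ≡ m₁ → m ≡ m₂ → x ≡ a * x₁ + b * x₂ →
      s * (m * x) ≡ a * (s * (m₁ * x₁)) + b * (s * (m₂ * x₂))
    linear-cofactor a b s m x₁ x₂ refl refl refl = ring a b s m x₁ x₂
      where
      ring : ∀ a b s m x₁ x₂ → s * (m * (a * x₁ + b * x₂)) ≡ a * (s * (m * x₁)) + b * (s * (m * x₂))
      ring = solve-∀

  detℤ-linear : (r : Fin n) {M M₁ M₂ : Matrix n} (a b : ℤ) →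
    (∀ i → i ≢ r → M i ≗ M₁ i) → (∀ i → i ≢ r → M i ≗ M₂ i) →
    (∀ c → M r c ≡ a * M₁ r c + b * M₂ r c) →
    detℤ M ≡ a * detℤ M₁ + b * detℤ M₂
  detℤ-linear {suc n} zero {M} {M₁} {M₂} a b eq₁ eq₂ eqᵣ =
    sum-linear {f = laplaceTerm M} a b (laplaceTerm M₁) (laplaceTerm M₂) λ j →
      linear-entry a b (signFin j) (M₁ zero j) (M₂ zero j) (eqᵣ j)
        (detℤ-cong λ r c → eq₁ (suc r) (λ ()) (punchIn j c))
        (detℤ-cong λ r c → eq₂ (suc r) (λ ()) (punchIn j c))
  detℤ-linear {suc n} (suc r) {M} {M₁} {M₂} a b eq₁ eq₂ eqᵣ =
    sum-linear {f = laplaceTerm M} a b (laplaceTerm M₁) (laplaceTerm M₂) λ j →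
      linear-cofactor a b (signFin j) (M zero j) (detℤ (minor M₁ j)) (detℤ (minor M₂ j))
        (eq₁ zero (λ ()) j) (eq₂ zero (λ ()) j)
        (detℤ-linear r a b (λ i i≢r c → eq₁ (suc i) (i≢r ∘ suc-injective) (punchIn j c))
                           (λ i i≢r c → eq₂ (suc i) (i≢r ∘ suc-injective) (punchIn j c))
                           (λ c → eqᵣ (punchIn j c)))

  detℤ-additive : (r : Fin n) {M M₁ M₂ : Matrix n} →
    (∀ i → i ≢ r → M i ≗ M₁ i) → (∀ i → i ≢ r → M i ≗ M₂ i) →
    (∀ c → M r c ≡ M₁ r c + M₂ r c) → detℤ M ≡ detℤ M₁ + detℤ M₂
  detℤ-additive r {M₁ = M₁} {M₂} eq₁ eq₂ eqᵣ =
    trans (detℤ-linear r 1ℤ 1ℤ eq₁ eq₂ λ c → trans (eqᵣ c) (ring (M₁ r c) (M₂ r c)))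
          (sym (ring (detℤ M₁) (detℤ M₂)))
    where
    ring : ∀ x y → x + y ≡ 1ℤ * x + 1ℤ * y
    ring = solve-∀

  Extensional : ((Fin k → Fin n) → ℤ) → Set
  Extensional D = ∀ {σ τ} → σ ≗ τ → D σ ≡ D τ

  -- Laplace expansion along the first two rows, v and w; D σ stands for the determinant of the
  -- remaining rows restricted to the columns σ.
  expand₁ : ((Fin k → Fin (2 ℕ.+ k)) → ℤ) → (w : Fin (2 ℕ.+ k) → ℤ) → Fin (2 ℕ.+ k) → ℤ
  expand₁ D w j = sum λ l → signFin l * (w (punchIn j l) * D (punchIn j ∘ punchIn l))

  expand₂ : ((Fin k → Fin (2 ℕ.+ k)) → ℤ) → (v w : Fin (2 ℕ.+ k) → ℤ) → ℤ
  expand₂ D v w = sum λ j → signFin j * (v j * expand₁ D w j)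

  expand₂-cong : ∀ (D : (Fin k → Fin (2 ℕ.+ k)) → ℤ) {v v′ w w′} → v ≗ v′ → w ≗ w′ →
    expand₂ D v w ≡ expand₂ D v′ w′
  expand₂-cong D eqᵥ eqʷ = sum-cong-≗ λ j → cong₂ (λ x y → signFin j * (x * y)) (eqᵥ j)
    (sum-cong-≗ λ l → cong (λ x → signFin l * (x * D (punchIn j ∘ punchIn l))) (eqʷ (punchIn j l)))

  private
    expand₁-suc : ∀ (D : (Fin (suc k) → Fin (3 ℕ.+ k)) → ℤ) → Extensional D → ∀ w j →
      expand₁ D w (suc j) ≡ 1ℤ * (w zero * D (suc ∘ punchIn j)) + - expand₁ (D ∘ lift 1) (w ∘ suc) j
    expand₁-suc D ext w j = cong (1ℤ * (w zero * D (suc ∘ punchIn j)) +_) (begin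
      sum (λ l → - signFin l * (w (suc (punchIn j l)) * D (punchIn (suc j) ∘ punchIn (suc l))))
        ≡⟨ sum-cong-≗ (λ l → trans (cong (λ x → - signFin l * (w (suc (punchIn j l)) * x)) (ext (lift-punchIn l)))
                                   (neg-mul (signFin l) _)) ⟩
      sum (λ l → - (signFin l * (w (suc (punchIn j l)) * D (lift 1 (punchIn j ∘ punchIn l)))))
        ≡⟨ sum-neg (λ l → signFin l * (w (suc (punchIn j l)) * D (lift 1 (punchIn j ∘ punchIn l)))) ⟩
      - expand₁ (D ∘ lift 1) (w ∘ suc) j ∎)
      where
      lift-punchIn : ∀ l → punchIn (suc j) ∘ punchIn (suc l) ≗ lift 1 (punchIn j ∘ punchIn l)
      lift-punchIn l zero    = refl
      lift-punchIn l (suc c) = refl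
      neg-mul : ∀ s x → - s * x ≡ - (s * x)
      neg-mul = solve-∀

    expand₂-suc : ∀ (D : (Fin (suc k) → Fin (3 ℕ.+ k)) → ℤ) → Extensional D → ∀ v w →
      expand₂ D v w ≡ v zero * expand₁ D w zero - w zero * expand₁ D v zero
                      + expand₂ (D ∘ lift 1) (v ∘ suc) (w ∘ suc)
    expand₂-suc D ext v w = begin
      1ℤ * (v zero * expand₁ D w zero) + sum (λ j → - signFin j * (v (suc j) * expand₁ D w (suc j)))
        ≡⟨ cong₂ _+_ (ring₁ (v zero * expand₁ D w zero))
                     (sum-linear (- w zero) 1ℤ (λ j → signFin j * (v (suc j) * D (suc ∘ punchIn j)))
                                               (λ j → signFin j * (v (suc j) * expand₁ D′ (w ∘ suc) j)) split) ⟩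
      v zero * expand₁ D w zero + (- w zero * expand₁ D v zero + 1ℤ * expand₂ D′ (v ∘ suc) (w ∘ suc))
        ≡⟨ ring₂ (v zero) (w zero) (expand₁ D w zero) (expand₁ D v zero) (expand₂ D′ (v ∘ suc) (w ∘ suc)) ⟩
      v zero * expand₁ D w zero - w zero * expand₁ D v zero + expand₂ D′ (v ∘ suc) (w ∘ suc) ∎
      where
      D′ = D ∘ lift 1
      ring₁ : ∀ x → 1ℤ * x ≡ x
      ring₁ = solve-∀
      ring₂ : ∀ v₀ w₀ z z′ e → v₀ * z + (- w₀ * z′ + 1ℤ * e) ≡ v₀ * z - w₀ * z′ + e
      ring₂ = solve-∀
      ring₃ : ∀ s a w₀ y e → - s * (a * (1ℤ * (w₀ * y) + - e)) ≡ - w₀ * (s * (a * y)) + 1ℤ * (s * (a * e))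
      ring₃ = solve-∀
      split : ∀ j → - signFin j * (v (suc j) * expand₁ D w (suc j))
                    ≡ - w zero * (signFin j * (v (suc j) * D (suc ∘ punchIn j)))
                      + 1ℤ * (signFin j * (v (suc j) * expand₁ D′ (w ∘ suc) j))
      split j = trans (cong (λ x → - signFin j * (v (suc j) * x)) (expand₁-suc D ext w j))
                      (ring₃ (signFin j) (v (suc j)) (w zero) (D (suc ∘ punchIn j)) (expand₁ D′ (w ∘ suc) j))

  expand₂-antisym : ∀ (D : (Fin k → Fin (2 ℕ.+ k)) → ℤ) → Extensional D → ∀ v w →
    expand₂ D v w ≡ - expand₂ D w v
  expand₂-antisym {zero} D ext v w = antisym₀ (ext (λ ()))
    where
    antisym₀ : ∀ {x y} → x ≡ y →
      1ℤ * (v zero * (1ℤ * (w (suc zero) * x) + 0ℤ)) + (-1ℤ * (v (suc zero) * (1ℤ * (w zero * y) + 0ℤ)) + 0ℤ)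
      ≡ - (1ℤ * (w zero * (1ℤ * (v (suc zero) * x) + 0ℤ)) + (-1ℤ * (w (suc zero) * (1ℤ * (v zero * y) + 0ℤ)) + 0ℤ))
    antisym₀ {x} refl = ring (v zero) (v (suc zero)) (w zero) (w (suc zero)) x
      where
      ring : ∀ v₀ v₁ w₀ w₁ x →
        1ℤ * (v₀ * (1ℤ * (w₁ * x) + 0ℤ)) + (-1ℤ * (v₁ * (1ℤ * (w₀ * x) + 0ℤ)) + 0ℤ)
        ≡ - (1ℤ * (w₀ * (1ℤ * (v₁ * x) + 0ℤ)) + (-1ℤ * (w₁ * (1ℤ * (v₀ * x) + 0ℤ)) + 0ℤ))
      ring = solve-∀
  expand₂-antisym {suc k} D ext v w = begin
    expand₂ D v w
      ≡⟨ expand₂-suc D ext v w ⟩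
    v zero * expand₁ D w zero - w zero * expand₁ D v zero + expand₂ D′ (v ∘ suc) (w ∘ suc)
      ≡⟨ cong (v zero * expand₁ D w zero - w zero * expand₁ D v zero +_)
              (expand₂-antisym D′ ext′ (v ∘ suc) (w ∘ suc)) ⟩
    v zero * expand₁ D w zero - w zero * expand₁ D v zero + - expand₂ D′ (w ∘ suc) (v ∘ suc)
      ≡⟨ ring (v zero * expand₁ D w zero) (w zero * expand₁ D v zero) (expand₂ D′ (w ∘ suc) (v ∘ suc)) ⟩
    - (w zero * expand₁ D v zero - v zero * expand₁ D w zero + expand₂ D′ (w ∘ suc) (v ∘ suc))
      ≡⟨ cong -_ (expand₂-suc D ext w v) ⟨
    - expand₂ D w v ∎
    where
    D′ = D ∘ lift 1
    ext′ : Extensional D′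
    ext′ eq = ext λ { zero → refl ; (suc c) → cong suc (eq c) }
    ring : ∀ x y e → x - y + - e ≡ - (y - x + e)
    ring = solve-∀

  detℤ-alternating₀₁ : (M : Matrix (2 ℕ.+ k)) → M zero ≗ M (suc zero) → detℤ M ≡ 0ℤ
  detℤ-alternating₀₁ M eq = x≡-x⇒x≡0 (begin
    expand₂ D (M zero) (M (suc zero))   ≡⟨ expand₂-antisym D ext (M zero) (M (suc zero)) ⟩
    - expand₂ D (M (suc zero)) (M zero) ≡⟨ cong -_ (expand₂-cong D (sym ∘ eq) eq) ⟩
    - expand₂ D (M zero) (M (suc zero)) ∎)
    where
    D : (Fin _ → Fin _) → ℤ
    D σ = detℤ λ r c → M (suc (suc r)) (σ c)
    ext : Extensional D
    ext eq′ = detℤ-cong λ r c → cong (M (suc (suc r))) (eq′ c)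

  private
    alternating-below-first : (∀ (M : Matrix n) {p q} → p ≢ q → M p ≗ M q → detℤ M ≡ 0ℤ) →
      (M : Matrix (suc n)) {p q : Fin n} → p ≢ q → M (suc p) ≗ M (suc q) → detℤ M ≡ 0ℤ
    alternating-below-first alternating M p≢q eq = sum-zero λ j →
      trans (cong (λ x → signFin j * (M zero j * x)) (alternating (minor M j) p≢q (eq ∘ punchIn j)))
            (ring (signFin j) (M zero j))
      where
      ring : ∀ s m → s * (m * 0ℤ) ≡ 0ℤ
      ring = solve-∀

    withRows : Matrix (2 ℕ.+ n) → Fin n → (u w : Fin (2 ℕ.+ n) → ℤ) → Matrix (2 ℕ.+ n)
    withRows M q u w zero          = M zero
    withRows M q u w (suc zero)    = u
    withRows M q u w (suc (suc i)) = updateAt (tail (tail M)) q (const w) i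

    withRows-q : ∀ (M : Matrix (2 ℕ.+ n)) q u w → withRows M q u w (suc (suc q)) ≗ w
    withRows-q M q u w = cong-app (updateAt-updates q (tail (tail M)))

    withRows-others : ∀ (M : Matrix (2 ℕ.+ n)) q u w i → i ≢ q → withRows M q u w (suc (suc i)) ≗ M (suc (suc i))
    withRows-others M q u w i i≢q = cong-app (updateAt-minimal i q (tail (tail M)) i≢q)

    -- With s = M 0 + M 1 in rows 1 and q + 2 the matrix is singular; expanding it by linearity in
    -- these two rows, every term except det M has two equal rows.
    alternating-first :
      (∀ (M : Matrix (suc n)) {p q : Fin n} → p ≢ q → M (suc p) ≗ M (suc q) → detℤ M ≡ 0ℤ) →
      (M : Matrix (suc n)) (q : Fin n) → M zero ≗ M (suc q) → detℤ M ≡ 0ℤ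
    alternating-first below M zero    eq = detℤ-alternating₀₁ M eq
    alternating-first below M (suc q) eq = sym (begin
      0ℤ
        ≡⟨ equal-below s ⟨
      detℤ (P s s)
        ≡⟨ detℤ-additive (suc zero) {M₁ = P v s} {P y s} (row₁-others s) (row₁-others s) (λ _ → refl) ⟩
      detℤ (P v s) + detℤ (P y s)
        ≡⟨ cong₂ _+_ (split-q v) (split-q y) ⟩
      (detℤ (P v v) + detℤ (P v y)) + (detℤ (P y v) + detℤ (P y y))
        ≡⟨ cong₂ _+_ (cong₂ _+_ (equal-first v) (equal-first y)) (cong₂ _+_ restore (equal-below y)) ⟩
      (0ℤ + 0ℤ) + (detℤ M + 0ℤ)
        ≡⟨ ring (detℤ M) ⟩
      detℤ M ∎)
      where
      P = withRows M q
      v = M zero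
      y = M (suc zero)
      s : Fin _ → ℤ
      s c = v c + y c
      ring : ∀ x → (0ℤ + 0ℤ) + (x + 0ℤ) ≡ x
      ring = solve-∀
      equal-below : ∀ u → detℤ (P u u) ≡ 0ℤ
      equal-below u = below (P u u) {zero} {suc q} (λ ()) (sym ∘ withRows-q M q u u)
      equal-first : ∀ w → detℤ (P v w) ≡ 0ℤ
      equal-first w = detℤ-alternating₀₁ (P v w) λ _ → refl
      restore : detℤ (P y v) ≡ detℤ M
      restore = detℤ-cong {M = P y v} {N = M} λ where
        zero          c → refl
        (suc zero)    c → refl
        (suc (suc i)) c → case i Fin.≟ q of λ where
          (yes refl) → trans (withRows-q M q y v c) (eq c)
          (no i≢q)   → withRows-others M q y v i i≢q c
      row₁-others : ∀ w {u u′} i → i ≢ suc zero → P u w i ≗ P u′ w i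
      row₁-others w zero          _   _ = refl
      row₁-others w (suc zero)    i≢1 _ = ⊥-elim (i≢1 refl)
      row₁-others w (suc (suc i)) _   _ = refl
      rowq-others : ∀ u w w′ i → i ≢ suc (suc q) → P u w i ≗ P u w′ i
      rowq-others u w w′ zero          _   _ = refl
      rowq-others u w w′ (suc zero)    _   _ = refl
      rowq-others u w w′ (suc (suc i)) i≢q c = trans (withRows-others M q u w i i≢q′ c)
                                                     (sym (withRows-others M q u w′ i i≢q′ c))
        where i≢q′ = i≢q ∘ cong (λ j → suc (suc j))
      split-q : ∀ u → detℤ (P u s) ≡ detℤ (P u v) + detℤ (P u y)
      split-q u = detℤ-additive (suc (suc q)) {M₁ = P u v} {P u y} (rowq-others u s v) (rowq-others u s y) λ c →
        trans (withRows-q M q u s c) (sym (cong₂ _+_ (withRows-q M q u v c) (withRows-q M q u y c)))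

  detℤ-alternating : (M : Matrix n) {p q : Fin n} → p ≢ q → M p ≗ M q → detℤ M ≡ 0ℤ
  detℤ-alternating {suc n} M {zero}  {zero}  p≢q _  = ⊥-elim (p≢q refl)
  detℤ-alternating {suc n} M {suc p} {suc q} p≢q eq =
    alternating-below-first (detℤ-alternating {n}) M (p≢q ∘ cong suc) eq
  detℤ-alternating {suc n} M {zero}  {suc q} _   eq =
    alternating-first (alternating-below-first (detℤ-alternating {n})) M q eq
  detℤ-alternating {suc n} M {suc p} {zero}  _   eq =
    alternating-first (alternating-below-first (detℤ-alternating {n})) M p (sym ∘ eq)

  detℤ-combine : ∀ {r s : Fin n} {M N : Matrix n} (d a b : ℤ) → r ≢ s →
    (∀ i → i ≢ r → N i ≗ M i) → (∀ c → d * N r c ≡ a * M r c + b * M s c) →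
    d * detℤ N ≡ a * detℤ M
  detℤ-combine {r = r} {s} {M} {N} d a b r≢s eqₒ eqᵣ = begin
    d * detℤ N                ≡⟨ ring₁ d (detℤ N) ⟩
    d * detℤ N + 0ℤ * detℤ N  ≡⟨ scaled ⟨
    detℤ K                    ≡⟨ combined ⟩
    a * detℤ M + b * detℤ L   ≡⟨ cong (λ x → a * detℤ M + b * x) L-singular ⟩
    a * detℤ M + b * 0ℤ       ≡⟨ ring₂ (a * detℤ M) b ⟩
    a * detℤ M                ∎
    where
    K L : Matrix _
    K = updateAt M r (const λ c → d * N r c)
    L = updateAt M r (const (M s))
    K-others : ∀ i → i ≢ r → K i ≡ M i
    K-others i i≢r = updateAt-minimal i r M i≢r
    ring₁ : ∀ d x → d * x ≡ d * x + 0ℤ * x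
    ring₁ = solve-∀
    ring₂ : ∀ x b → x + b * 0ℤ ≡ x
    ring₂ = solve-∀
    scaled : detℤ K ≡ d * detℤ N + 0ℤ * detℤ N
    scaled = detℤ-linear r d 0ℤ (λ i i≢r c → trans (cong-app (K-others i i≢r) c) (sym (eqₒ i i≢r c)))
                               (λ i i≢r c → trans (cong-app (K-others i i≢r) c) (sym (eqₒ i i≢r c)))
                               (λ c → trans (cong-app (updateAt-updates r M) c) (ring₁ d (N r c)))
    combined : detℤ K ≡ a * detℤ M + b * detℤ L
    combined = detℤ-linear r a b (λ i i≢r → cong-app (K-others i i≢r))
                                 (λ i i≢r → cong-app (trans (K-others i i≢r) (sym (updateAt-minimal i r M i≢r))))
                                 (λ c → begin
                                   K r c                  ≡⟨ cong-app (updateAt-updates r M) c ⟩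
                                   d * N r c              ≡⟨ eqᵣ c ⟩
                                   a * M r c + b * M s c  ≡⟨ cong (λ x → a * M r c + b * x)
                                                                   (cong-app (updateAt-updates r M) c) ⟨
                                   a * M r c + b * L r c  ∎)
    L-singular : detℤ L ≡ 0ℤ
    L-singular = detℤ-alternating L r≢s λ c →
      trans (cong-app (updateAt-updates r M) c) (sym (cong-app (updateAt-minimal s r M (r≢s ∘ sym)) c))

  private
    mixRows : ℕ → Matrix (suc k) → Matrix (suc k) → Matrix (suc k)
    mixRows m M N zero    = M zero
    mixRows m M N (suc i) = if does (toℕ i <? m) then N (suc i) else M (suc i)

    mixRows-step : ∀ {M N : Matrix (suc k)} (d a : ℤ) (c : Fin k → ℤ) →
      (∀ i j → d * N (suc i) j ≡ a * M (suc i) j + c i * M zero j) →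
      ∀ {m} (m<k : m ℕ.< k) → d * detℤ (mixRows (suc m) M N) ≡ a * detℤ (mixRows m M N)
    mixRows-step {M = M} {N} d a c eq {m} m<k =
      detℤ-combine {r = suc i₀} {zero} d a (c i₀) (λ ()) others row
      where
      i₀ = fromℕ< m<k
      pick : ∀ i → Bool → Fin (suc _) → ℤ
      pick i b = if b then N (suc i) else M (suc i)
      same-test : ∀ x → x ≢ m → Dec (x ℕ.< m) → does (x <? suc m) ≡ does (x <? m)
      same-test x _   (yes x<m) = trans (dec-true (x <? suc m) (ℕ.m<n⇒m<1+n x<m)) (sym (dec-true (x <? m) x<m))
      same-test x x≢m (no x≮m)  =
        trans (dec-false (x <? suc m) λ x<1+m → x≮m (ℕ.≤∧≢⇒< (ℕ.m<1+n⇒m≤n x<1+m) x≢m))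
              (sym (dec-false (x <? m) x≮m))
      others : ∀ i → i ≢ suc i₀ → mixRows (suc m) M N i ≗ mixRows m M N i
      others zero    _    _ = refl
      others (suc i) i≢i₀ j = cong (λ b → pick i b j) (same-test (toℕ i)
        (λ i≡m → i≢i₀ (cong suc (toℕ-injective (trans i≡m (sym (toℕ-fromℕ< m<k)))))) (toℕ i <? m))
      row : ∀ j → d * mixRows (suc m) M N (suc i₀) j ≡ a * mixRows m M N (suc i₀) j + c i₀ * M zero j
      row j = begin
        d * pick i₀ (does (toℕ i₀ <? suc m)) j
          ≡⟨ cong (λ b → d * pick i₀ b j) (dec-true (toℕ i₀ <? suc m) i₀<1+m) ⟩
        d * N (suc i₀) j
          ≡⟨ eq i₀ j ⟩
        a * M (suc i₀) j + c i₀ * M zero j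
          ≡⟨ cong (λ b → a * pick i₀ b j + c i₀ * M zero j) (dec-false (toℕ i₀ <? m) i₀≮m) ⟨
        a * pick i₀ (does (toℕ i₀ <? m)) j + c i₀ * M zero j ∎
        where
        i₀<1+m = subst (ℕ._< suc m) (sym (toℕ-fromℕ< m<k)) (ℕ.n<1+n m)
        i₀≮m = ℕ.<-irrefl (toℕ-fromℕ< m<k)

  detℤ-eliminate : ∀ {M N : Matrix (suc k)} (d a : ℤ) (c : Fin k → ℤ) → N zero ≗ M zero →
    (∀ i j → d * N (suc i) j ≡ a * M (suc i) j + c i * M zero j) →
    d ^ k * detℤ N ≡ a ^ k * detℤ M
  detℤ-eliminate {k} {M} {N} d a c eq₀ eq = begin
    d ^ k * detℤ N                ≡⟨ cong (d ^ k *_) (detℤ-cong mix-all) ⟩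
    d ^ k * detℤ (mixRows k M N)  ≡⟨ go k ℕ.≤-refl ⟩
    a ^ k * detℤ (mixRows 0 M N)  ≡⟨ cong (a ^ k *_) (detℤ-cong mix-none) ⟩
    a ^ k * detℤ M                ∎
    where
    mix-all : ∀ i j → N i j ≡ mixRows k M N i j
    mix-all zero    j = eq₀ j
    mix-all (suc i) j = cong (λ b → (if b then N (suc i) else M (suc i)) j) (sym (dec-true (toℕ i <? k) (toℕ<n i)))
    mix-none : ∀ i j → mixRows 0 M N i j ≡ M i j
    mix-none zero    j = refl
    mix-none (suc i) j = refl
    go : ∀ m → m ℕ.≤ k → d ^ m * detℤ (mixRows m M N) ≡ a ^ m * detℤ (mixRows 0 M N)
    go zero    _   = refl
    go (suc m) m<k = begin
      d * d ^ m * detℤ (mixRows (suc m) M N)   ≡⟨ ring (d ^ m) d (detℤ (mixRows (suc m) M N)) ⟩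
      d ^ m * (d * detℤ (mixRows (suc m) M N)) ≡⟨ cong (d ^ m *_) (mixRows-step {M = M} {N} d a c eq m<k) ⟩
      d ^ m * (a * detℤ (mixRows m M N))       ≡⟨ ring′ (d ^ m) a (detℤ (mixRows m M N)) ⟩
      a * (d ^ m * detℤ (mixRows m M N))       ≡⟨ cong (a *_) (go m (ℕ.<⇒≤ m<k)) ⟩
      a * (a ^ m * detℤ (mixRows 0 M N))       ≡⟨ ring″ a (a ^ m) (detℤ (mixRows 0 M N)) ⟩
      a * a ^ m * detℤ (mixRows 0 M N)         ∎
      where
      ring : ∀ x d y → d * x * y ≡ x * (d * y)
      ring = solve-∀
      ring′ : ∀ x a y → x * (a * y) ≡ a * (x * y)
      ring′ = solve-∀
      ring″ : ∀ a x y → a * (x * y) ≡ a * x * y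
      ring″ = solve-∀

  detℤ-zeroColumn : {M : Matrix (suc n)} → (∀ i → M i zero ≡ 0ℤ) → detℤ M ≡ 0ℤ
  detℤ-zeroColumn {zero}      z = cong (λ x → 1ℤ * (x * 1ℤ) + 0ℤ) (z zero)
  detℤ-zeroColumn {suc n} {M} z = sum-zero term-zero
    where
    ring : ∀ s m → s * (m * 0ℤ) ≡ 0ℤ
    ring = solve-∀
    term-zero : ∀ j → laplaceTerm M j ≡ 0ℤ
    term-zero zero    = cong (λ x → 1ℤ * (x * detℤ (minor M zero))) (z zero)
    term-zero (suc j) =
      trans (cong (λ x → signFin (suc j) * (M zero (suc j) * x)) (detℤ-zeroColumn {M = minor M (suc j)} (z ∘ suc)))
            (ring (signFin (suc j)) (M zero (suc j)))

  detℤ-firstColumn : {M : Matrix (suc n)} → (∀ i → M (suc i) zero ≡ 0ℤ) →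
    detℤ M ≡ M zero zero * detℤ (minor M zero)
  detℤ-firstColumn {zero}  {M} z = ring (M zero zero * 1ℤ)
    where
    ring : ∀ x → 1ℤ * x + 0ℤ ≡ x
    ring = solve-∀
  detℤ-firstColumn {suc n} {M} z = trans
    (cong (laplaceTerm M zero +_) (sum-zero λ j →
      trans (cong (λ x → signFin (suc j) * (M zero (suc j) * x)) (detℤ-zeroColumn {M = minor M (suc j)} z))
            (ring₀ (signFin (suc j)) (M zero (suc j)))))
    (ring (M zero zero * detℤ (minor M zero)))
    where
    ring₀ : ∀ s m → s * (m * 0ℤ) ≡ 0ℤ
    ring₀ = solve-∀
    ring : ∀ x → 1ℤ * x + 0ℤ ≡ x
    ring = solve-∀

module Bareiss where

  open import Data.Fin using (Fin; zero; suc)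
  open import Data.Integer as ℤ using (ℤ; 0ℤ; 1ℤ; _+_; _*_; -_; _-_; _^_; _/_; _%_; ≢-nonZero)
  open import Data.Integer.DivMod using (a≡a%n+[a/n]*n)
  open import Data.Integer.Properties using (*-cancelˡ-≡; *-comm; +-identityˡ)
  open import Data.Integer.Tactic.RingSolver using (solve-∀)
  open import Data.Maybe using (Maybe; just; nothing)
  import Data.Nat as ℕ
  open import Data.Vec using (Vec; []; _∷_; lookup; map; zipWith)
  open import Data.Vec.Properties using (lookup-map; lookup-zipWith)
  open import Data.Vec.Relation.Unary.All using (All; all?)
  open import Data.Vec.Relation.Unary.All.Properties using (lookup⁺)
  open import Relation.Nullary using (Dec; yes; no)
  open Determinant
  open ≡-Reasoning

  private variable
    k m : ℕ

  toMatrix : Vec (Vec ℤ k) k → Matrix k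
  toMatrix V i j = lookup (lookup V i) j

  eliminateRow : ℤ → Vec ℤ k → Vec ℤ (suc k) → Vec ℤ k
  eliminateRow a x (q₀ ∷ q) = zipWith (λ xⱼ qⱼ → a * qⱼ - q₀ * xⱼ) x q

  -- Bareiss' fraction-free elimination, d being the previous pivot: the rows q below the pivot row
  -- a ∷ x become (a q − q₀ x) / d.  Sylvester's identity makes the division exact; here exactness is
  -- checked instead, and a vanishing pivot makes the computation fail.  The eliminated rows are an
  -- argument of bareiss-pivot so that they are computed only once.
  mutual
    bareiss : (d : ℤ) .{{_ : ℤ.NonZero d}} → Vec (Vec ℤ (suc k)) (suc k) → Maybe ℤ
    bareiss {zero}  d ((a ∷ []) ∷ []) = just a
    bareiss {suc k} d ((a ∷ x) ∷ Q)   = bareiss-pivot d a (map (eliminateRow a x) Q) (a ℤ.≟ 0ℤ)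

    bareiss-pivot : (d : ℤ) .{{_ : ℤ.NonZero d}} (a : ℤ) → Vec (Vec ℤ (suc k)) (suc k) →
      Dec (a ≡ 0ℤ) → Maybe ℤ
    bareiss-pivot d a Y (yes _)  = nothing
    bareiss-pivot d a Y (no a≢0) = bareiss-divide d a {{≢-nonZero a≢0}} Y (all? (all? λ y → y % d ℕ.≟ 0) Y)

    bareiss-divide : (d : ℤ) .{{_ : ℤ.NonZero d}} (a : ℤ) .{{_ : ℤ.NonZero a}} (Y : Vec (Vec ℤ (suc k)) (suc k)) →
      Dec (All (All λ y → y % d ≡ 0) Y) → Maybe ℤ
    bareiss-divide d a Y (yes _) = bareiss a (map (map (_/ d)) Y)
    bareiss-divide d a Y (no _)  = nothing

  private
    *-/-exact : ∀ y d .{{_ : ℤ.NonZero d}} → y % d ≡ 0 → d * (y / d) ≡ y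
    *-/-exact y d y%d≡0 = begin
      d * (y / d)                ≡⟨ *-comm d (y / d) ⟩
      y / d * d                  ≡⟨ +-identityˡ (y / d * d) ⟨
      ℤ.+ 0 + y / d * d          ≡⟨ cong (λ r → ℤ.+ r + y / d * d) y%d≡0 ⟨
      ℤ.+ (y % d) + y / d * d    ≡⟨ a≡a%n+[a/n]*n y d ⟨
      y                          ∎

    eliminateRow-lookup : ∀ a (x : Vec ℤ k) row j →
      lookup (eliminateRow a x row) j ≡ a * lookup row (suc j) - lookup row zero * lookup x j
    eliminateRow-lookup a x (q₀ ∷ q) j = lookup-zipWith _ j x q

    elimination-step : (d a : ℤ) .{{_ : ℤ.NonZero d}} .{{_ : ℤ.NonZero a}} (x : Vec ℤ (suc k))
      (Q : Vec (Vec ℤ (2 ℕ.+ k)) (suc k)) {F : ℤ} →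
      All (All λ y → y % d ≡ 0) (map (eliminateRow a x) Q) →
      a ^ k * F ≡ detℤ (toMatrix (map (map (_/ d)) (map (eliminateRow a x) Q))) →
      d ^ suc k * F ≡ detℤ (toMatrix ((a ∷ x) ∷ Q))
    elimination-step {k} d a x Q {F} divisible ih = *-cancelˡ-≡ (a ^ suc k) _ _ {{^-nonZero a (suc k)}} (begin
      a ^ suc k * (d ^ suc k * F)      ≡⟨ ring a (a ^ k) (d ^ suc k) F ⟩
      d ^ suc k * (a * (a ^ k * F))    ≡⟨ cong (λ z → d ^ suc k * (a * z))
                                               (trans ih (detℤ-cong λ r c → sym (below r c))) ⟩
      d ^ suc k * (a * detℤ (minor N zero)) ≡⟨ cong (d ^ suc k *_) (detℤ-firstColumn {M = N} first-column) ⟨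
      d ^ suc k * detℤ N               ≡⟨ detℤ-eliminate {M = M} {N} d a (λ i → - M (suc i) zero)
                                                                  (λ _ → refl) rows ⟩
      a ^ suc k * detℤ M               ∎)
      where
      Y = map (eliminateRow a x) Q
      W = map (map (_/ d)) Y
      M N : Matrix (2 ℕ.+ k)
      M = toMatrix ((a ∷ x) ∷ Q)
      N = toMatrix ((a ∷ x) ∷ map (0ℤ ∷_) W)
      ring : ∀ a aᵏ dᵏ F → a * aᵏ * (dᵏ * F) ≡ dᵏ * (a * (aᵏ * F))
      ring = solve-∀
      row-of-N : ∀ i → lookup (map (0ℤ ∷_) W) i ≡ 0ℤ ∷ lookup W i
      row-of-N i = lookup-map i (0ℤ ∷_) W
      first-column : ∀ i → N (suc i) zero ≡ 0ℤ
      first-column i = cong (λ row → lookup row zero) (row-of-N i)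
      below : ∀ r c → N (suc r) (suc c) ≡ toMatrix W r c
      below r c = cong (λ row → lookup row (suc c)) (row-of-N r)
      quotient : ∀ i j → d * toMatrix W i j ≡ lookup (lookup Y i) j
      quotient i j = begin
        d * lookup (lookup W i) j                ≡⟨ cong (λ row → d * lookup row j) (lookup-map i (map (_/ d)) Y) ⟩
        d * lookup (map (_/ d) (lookup Y i)) j   ≡⟨ cong (d *_) (lookup-map j (_/ d) (lookup Y i)) ⟩
        d * (lookup (lookup Y i) j / d)          ≡⟨ *-/-exact _ d (lookup⁺ (lookup⁺ divisible i) j) ⟩
        lookup (lookup Y i) j                    ∎
      rows : ∀ i j → d * N (suc i) j ≡ a * M (suc i) j + - M (suc i) zero * M zero j
      rows i zero    = begin
        d * N (suc i) zero                          ≡⟨ cong (d *_) (first-column i) ⟩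
        d * 0ℤ                                      ≡⟨ ring₀ d a (M (suc i) zero) ⟩
        a * M (suc i) zero + - M (suc i) zero * a   ∎
        where
        ring₀ : ∀ d a q → d * 0ℤ ≡ a * q + - q * a
        ring₀ = solve-∀
      rows i (suc j) = begin
        d * N (suc i) (suc j)                       ≡⟨ cong (d *_) (below i j) ⟩
        d * toMatrix W i j                          ≡⟨ quotient i j ⟩
        lookup (lookup Y i) j
          ≡⟨ cong (λ row → lookup row j) (lookup-map i (eliminateRow a x) Q) ⟩
        lookup (eliminateRow a x (lookup Q i)) j
          ≡⟨ eliminateRow-lookup a x (lookup Q i) j ⟩
        a * M (suc i) (suc j) - M (suc i) zero * M zero (suc j)
          ≡⟨ ring₁ a (M (suc i) (suc j)) (M (suc i) zero) (M zero (suc j)) ⟩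
        a * M (suc i) (suc j) + - M (suc i) zero * M zero (suc j) ∎
        where
        ring₁ : ∀ a q q₀ x → a * q - q₀ * x ≡ a * q + - q₀ * x
        ring₁ = solve-∀

  bareiss-sound : (d : ℤ) .{{_ : ℤ.NonZero d}} (V : Vec (Vec ℤ (suc k)) (suc k)) {F : ℤ} →
    bareiss d V ≡ just F → d ^ k * F ≡ detℤ (toMatrix V)
  bareiss-sound {zero}  d ((a ∷ []) ∷ []) refl = ring a
    where
    ring : ∀ a → 1ℤ * a ≡ 1ℤ * (a * 1ℤ) + 0ℤ
    ring = solve-∀
  bareiss-sound {suc k} d ((a ∷ x) ∷ Q) = pivot-sound (a ℤ.≟ 0ℤ)
    where
    Y = map (eliminateRow a x) Q
    divide-sound : ∀ .{{_ : ℤ.NonZero a}} {F} (divisible? : Dec (All (All λ y → y % d ≡ 0) Y)) →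
      bareiss-divide d a Y divisible? ≡ just F → d ^ suc k * F ≡ detℤ (toMatrix ((a ∷ x) ∷ Q))
    divide-sound (yes divisible) eq = elimination-step d a x Q divisible (bareiss-sound a (map (map (_/ d)) Y) eq)
    pivot-sound : ∀ {F} (a≟0 : Dec (a ≡ 0ℤ)) → bareiss-pivot d a Y a≟0 ≡ just F →
      d ^ suc k * F ≡ detℤ (toMatrix ((a ∷ x) ∷ Q))
    pivot-sound (no a≢0) = divide-sound {{≢-nonZero a≢0}} (all? (all? λ y → y % d ℕ.≟ 0) Y)

module Polynomial where

  open import Data.Bool using (if_then_else_)
  open import Data.Empty using (⊥-elim)
  open import Data.Fin using (Fin; zero; suc; punchIn)
  open import Data.Integer as ℤ using (ℤ; 0ℤ; 1ℤ; -1ℤ; _+_; _*_; -_; _-_)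
  open import Data.Integer.Properties
    using (+-*-semiring; +-identityˡ; +-identityʳ; *-zeroʳ; i*j≡0⇒i≡0∨j≡0; -1*i≡-i; neg-involutive)
  open import Algebra.Properties.Semiring.Sum +-*-semiring using (sum; sum-cong-≗)
  open import Data.Integer.Tactic.RingSolver using (solve-∀)
  open import Data.List using (List; []; _∷_; length)
  open import Data.List.Relation.Unary.All as All using (All; []; _∷_)
  open import Data.List.Relation.Unary.Unique.Propositional using (Unique; []; _∷_)
  open import Data.Nat as ℕ using (_≤_; z≤n; s≤s)
  open import Data.Nat.Properties as ℕ using (≤-trans)
  open import Data.Sum using (inj₁; inj₂)
  open import Relation.Nullary using (does)
  open Determinant
  open ≡-Reasoning

  private variable
    m n : ℕ

  evalₚ : ℤ → Poly → ℤ
  evalₚ t []      = 0ℤ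
  evalₚ t (a ∷ p) = a + t * evalₚ t p

  evalₚ-+ₚ : ∀ t p q → evalₚ t (p +ₚ q) ≡ evalₚ t p + evalₚ t q
  evalₚ-+ₚ t []      q       = sym (+-identityˡ _)
  evalₚ-+ₚ t (a ∷ p) []      = sym (+-identityʳ _)
  evalₚ-+ₚ t (a ∷ p) (b ∷ q) =
    trans (cong (λ z → a + b + t * z) (evalₚ-+ₚ t p q)) (ring a b t (evalₚ t p) (evalₚ t q))
    where
    ring : ∀ a b t x y → a + b + t * (x + y) ≡ a + t * x + (b + t * y)
    ring = solve-∀

  evalₚ-scaleₚ : ∀ t c p → evalₚ t (scaleₚ c p) ≡ c * evalₚ t p
  evalₚ-scaleₚ t c []      = sym (*-zeroʳ c)
  evalₚ-scaleₚ t c (a ∷ p) = trans (cong (λ z → c * a + t * z) (evalₚ-scaleₚ t c p)) (ring c a t (evalₚ t p))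
    where
    ring : ∀ c a t x → c * a + t * (c * x) ≡ c * (a + t * x)
    ring = solve-∀

  evalₚ-*ₚ : ∀ t p q → evalₚ t (p *ₚ q) ≡ evalₚ t p * evalₚ t q
  evalₚ-*ₚ t []      q = refl
  evalₚ-*ₚ t (a ∷ p) q = begin
    evalₚ t (scaleₚ a q +ₚ (0ℤ ∷ (p *ₚ q)))          ≡⟨ evalₚ-+ₚ t (scaleₚ a q) (0ℤ ∷ (p *ₚ q)) ⟩
    evalₚ t (scaleₚ a q) + (0ℤ + t * evalₚ t (p *ₚ q)) ≡⟨ cong₂ (λ u v → u + (0ℤ + t * v))
                                                                (evalₚ-scaleₚ t a q) (evalₚ-*ₚ t p q) ⟩
    a * evalₚ t q + (0ℤ + t * (evalₚ t p * evalₚ t q)) ≡⟨ ring a t (evalₚ t p) (evalₚ t q) ⟩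
    (a + t * evalₚ t p) * evalₚ t q                   ∎
    where
    ring : ∀ a t x y → a * y + (0ℤ + t * (x * y)) ≡ (a + t * x) * y
    ring = solve-∀

  evalₚ-sumFin : ∀ t (f : Fin n → Poly) → evalₚ t (sumFin f) ≡ sum (λ j → evalₚ t (f j))
  evalₚ-sumFin {zero}  t f = refl
  evalₚ-sumFin {suc n} t f =
    trans (evalₚ-+ₚ t (f zero) (sumFin (λ j → f (suc j))))
          (cong (evalₚ t (f zero) +_) (evalₚ-sumFin t (λ j → f (suc j))))

  private
    minorₚ : (Fin (suc n) → Fin (suc n) → Poly) → Fin (suc n) → Fin n → Fin n → Poly
    minorₚ M j r c = M (suc r) (punchIn j c)

    laplaceTermₚ : (Fin (suc n) → Fin (suc n) → Poly) → Fin (suc n) → Poly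
    laplaceTermₚ {n} M j = scaleₚ (signFin j) (M zero j *ₚ det n (minorₚ M j))

  evalₚ-det : ∀ t n (M : Fin n → Fin n → Poly) → evalₚ t (det n M) ≡ detℤ (λ i j → evalₚ t (M i j))
  evalₚ-det t zero    M = cong (1ℤ +_) (*-zeroʳ t)
  evalₚ-det t (suc n) M = trans (evalₚ-sumFin t (laplaceTermₚ M)) (sum-cong-≗ λ j → begin
    evalₚ t (scaleₚ (signFin j) (M zero j *ₚ det n (minorₚ M j)))
      ≡⟨ evalₚ-scaleₚ t (signFin j) (M zero j *ₚ det n (minorₚ M j)) ⟩
    signFin j * evalₚ t (M zero j *ₚ det n (minorₚ M j))
      ≡⟨ cong (signFin j *_) (evalₚ-*ₚ t (M zero j) (det n (minorₚ M j))) ⟩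
    signFin j * (evalₚ t (M zero j) * evalₚ t (det n (minorₚ M j)))
      ≡⟨ cong (λ z → signFin j * (evalₚ t (M zero j) * z)) (evalₚ-det t n (minorₚ M j)) ⟩
    signFin j * (evalₚ t (M zero j) * detℤ (λ r c → evalₚ t (minorₚ M j r c))) ∎)

  length-+ₚ : ∀ p q → length p ≤ m → length q ≤ m → length (p +ₚ q) ≤ m
  length-+ₚ []      q       _         q≤m       = q≤m
  length-+ₚ (a ∷ p) []      p≤m       _         = p≤m
  length-+ₚ (a ∷ p) (b ∷ q) (s≤s p≤m) (s≤s q≤m) = s≤s (length-+ₚ p q p≤m q≤m)

  length-scaleₚ : ∀ c p → length (scaleₚ c p) ≡ length p
  length-scaleₚ c []      = refl
  length-scaleₚ c (a ∷ p) = cong suc (length-scaleₚ c p)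

  length-*ₚ : ∀ p q → length q ≤ suc m → length (p *ₚ q) ≤ length p ℕ.+ m
  length-*ₚ []          q q≤1+m = z≤n
  length-*ₚ {m} (a ∷ p) q q≤1+m = length-+ₚ (scaleₚ a q) (0ℤ ∷ (p *ₚ q))
    (subst (_≤ suc (length p ℕ.+ m)) (sym (length-scaleₚ a q)) (≤-trans q≤1+m (s≤s (ℕ.m≤n+m m (length p)))))
    (s≤s (length-*ₚ p q q≤1+m))

  length-sumFin : (f : Fin n → Poly) → (∀ j → length (f j) ≤ m) → length (sumFin f) ≤ m
  length-sumFin {zero}  f _ = z≤n
  length-sumFin {suc n} f bound =
    length-+ₚ (f zero) _ (bound zero) (length-sumFin (λ j → f (suc j)) (λ j → bound (suc j)))

  length-det : ∀ n (M : Fin n → Fin n → Poly) → (∀ i j → length (M i j) ≤ 2) → length (det n M) ≤ suc n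
  length-det zero    M _     = s≤s z≤n
  length-det (suc n) M bound = length-sumFin (laplaceTermₚ M) λ j →
    subst (_≤ 2 ℕ.+ n) (sym (length-scaleₚ (signFin j) (M zero j *ₚ det n (minorₚ M j))))
      (≤-trans (length-*ₚ (M zero j) (det n (minorₚ M j))
                          (length-det n (minorₚ M j) (λ r c → bound (suc r) (punchIn j c))))
               (ℕ.+-monoˡ-≤ n (bound zero j)))

  length-δ : (i j : Fin n) → length (δ i j) ≤ 1
  length-δ zero    zero    = s≤s z≤n
  length-δ zero    (suc j) = z≤n
  length-δ (suc i) zero    = z≤n
  length-δ (suc i) (suc j) = length-δ i j

  length-charPoly : (A : Adj n) → length (charPoly A) ≤ suc n
  length-charPoly {n} A = length-det n _ λ i j →
    length-+ₚ (X *ₚ δ i j) _ (length-*ₚ X (δ i j) (length-δ i j)) (s≤s z≤n)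

  quotientₚ : ℤ → Poly → Poly
  quotientₚ a []                = []
  quotientₚ a (c ∷ [])          = []
  quotientₚ a (c ∷ p@(_ ∷ _))   = evalₚ a p ∷ quotientₚ a p

  remainder-theorem : ∀ t a p → evalₚ t p ≡ (t - a) * evalₚ t (quotientₚ a p) + evalₚ a p
  remainder-theorem t a []              = sym (ring t a)
    where
    ring : ∀ t a → (t - a) * 0ℤ + 0ℤ ≡ 0ℤ
    ring = solve-∀
  remainder-theorem t a (c ∷ [])        = ring t a c
    where
    ring : ∀ t a c → c + t * 0ℤ ≡ (t - a) * 0ℤ + (c + a * 0ℤ)
    ring = solve-∀
  remainder-theorem t a (c ∷ p@(_ ∷ _)) =
    trans (cong (λ z → c + t * z) (remainder-theorem t a p)) (ring t a c (evalₚ t (quotientₚ a p)) (evalₚ a p))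
    where
    ring : ∀ t a c q r → c + t * ((t - a) * q + r) ≡ (t - a) * (r + t * q) + (c + a * r)
    ring = solve-∀

  length-quotientₚ : ∀ a p → length (quotientₚ a p) ≡ ℕ.pred (length p)
  length-quotientₚ a []              = refl
  length-quotientₚ a (c ∷ [])        = refl
  length-quotientₚ a (c ∷ p@(_ ∷ _)) = cong suc (length-quotientₚ a p)

  IsZeroₚ : Poly → Set
  IsZeroₚ = All (_≡ 0ℤ)

  private
    c+a*0≡0 : ∀ {c} a → c + a * 0ℤ ≡ 0ℤ → c ≡ 0ℤ
    c+a*0≡0 {c} a eq = trans (sym (ring c a)) eq
      where
      ring : ∀ c a → c + a * 0ℤ ≡ c
      ring = solve-∀

  IsZeroₚ-from-quotient : ∀ a p → IsZeroₚ (quotientₚ a p) → evalₚ a p ≡ 0ℤ → IsZeroₚ p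
  IsZeroₚ-from-quotient a []              _           _  = []
  IsZeroₚ-from-quotient a (c ∷ [])        _           eq = c+a*0≡0 a eq ∷ []
  IsZeroₚ-from-quotient a (c ∷ p@(_ ∷ _)) (p[a]≡0 ∷ q≡0) eq =
    c+a*0≡0 a (trans (cong (λ z → c + a * z) (sym p[a]≡0)) eq) ∷ IsZeroₚ-from-quotient a p q≡0 p[a]≡0

  vanishing⇒IsZeroₚ : ∀ (ts : List ℤ) p → Unique ts → length p ≤ length ts →
    All (λ t → evalₚ t p ≡ 0ℤ) ts → IsZeroₚ p
  vanishing⇒IsZeroₚ []       []      _ _ _ = []
  vanishing⇒IsZeroₚ (a ∷ ts) p (a∉ts ∷ unique) p≤ts (p[a]≡0 ∷ p[ts]≡0) =
    IsZeroₚ-from-quotient a p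
      (vanishing⇒IsZeroₚ ts (quotientₚ a p) unique
        (subst (_≤ length ts) (sym (length-quotientₚ a p)) (ℕ.pred-mono-≤ p≤ts))
        (All.zipWith quotient-vanishes (a∉ts , p[ts]≡0)))
      p[a]≡0
    where
    quotient-vanishes : ∀ {b} → a ≢ b × evalₚ b p ≡ 0ℤ → evalₚ b (quotientₚ a p) ≡ 0ℤ
    quotient-vanishes {b} (a≢b , p[b]≡0)
      with i*j≡0⇒i≡0∨j≡0 (b - a) (begin
        (b - a) * evalₚ b (quotientₚ a p)          ≡⟨ +-identityʳ _ ⟨
        (b - a) * evalₚ b (quotientₚ a p) + 0ℤ     ≡⟨ cong ((b - a) * evalₚ b (quotientₚ a p) +_) p[a]≡0 ⟨
        (b - a) * evalₚ b (quotientₚ a p) + evalₚ a p ≡⟨ remainder-theorem b a p ⟨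
        evalₚ b p                                  ≡⟨ p[b]≡0 ⟩
        0ℤ                                         ∎)
    ... | inj₁ b-a≡0 = ⊥-elim (a≢b (sym (trans (sym (ring b a)) (trans (cong (_+ a) b-a≡0) (+-identityˡ a)))))
      where
      ring : ∀ b a → b - a + a ≡ b
      ring = solve-∀
    ... | inj₂ q[b]≡0 = q[b]≡0

  private
    consₙ : ℤ → Poly → Poly
    consₙ a []      = if does (a ℤ.≟ 0ℤ) then [] else a ∷ []
    consₙ a (b ∷ q) = a ∷ b ∷ q

    normₚ-∷ : ∀ a p → normₚ (a ∷ p) ≡ consₙ a (normₚ p)
    normₚ-∷ a p with normₚ p
    ... | []    = refl
    ... | b ∷ q = refl

    -1*x≡0 : ∀ {x} → -1ℤ * x ≡ 0ℤ → x ≡ 0ℤ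
    -1*x≡0 {x} eq = trans (sym (neg-involutive x)) (cong -_ (trans (sym (-1*i≡-i x)) eq))

    a-b≡0 : ∀ {a b} → a + -1ℤ * b ≡ 0ℤ → a ≡ b
    a-b≡0 {a} {b} eq = trans (sym (ring a b)) (trans (cong (_+ b) eq) (+-identityˡ b))
      where
      ring : ∀ a b → a + -1ℤ * b + b ≡ a
      ring = solve-∀

  normₚ-IsZeroₚ : ∀ p → IsZeroₚ p → normₚ p ≡ []
  normₚ-IsZeroₚ []      _          = refl
  normₚ-IsZeroₚ (a ∷ p) (refl ∷ z) = trans (normₚ-∷ 0ℤ p) (cong (consₙ 0ℤ) (normₚ-IsZeroₚ p z))

  ≈ₚ-from-difference : ∀ p q → IsZeroₚ (p +ₚ -ₚ q) → p ≈ₚ q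
  ≈ₚ-from-difference []      q       z       = sym (normₚ-IsZeroₚ q (All.map -1*x≡0 (unscale q z)))
    where
    unscale : ∀ q → IsZeroₚ (-ₚ q) → All (λ b → -1ℤ * b ≡ 0ℤ) q
    unscale []      _       = []
    unscale (b ∷ q) (e ∷ z) = e ∷ unscale q z
  ≈ₚ-from-difference (a ∷ p) []      z       = normₚ-IsZeroₚ (a ∷ p) z
  ≈ₚ-from-difference (a ∷ p) (b ∷ q) (e ∷ z) = begin
    normₚ (a ∷ p)          ≡⟨ normₚ-∷ a p ⟩
    consₙ a (normₚ p)      ≡⟨ cong₂ consₙ (a-b≡0 e) (≈ₚ-from-difference p q z) ⟩
    consₙ b (normₚ q)      ≡⟨ normₚ-∷ b q ⟨
    normₚ (b ∷ q)          ∎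

  ≈ₚ-by-evaluation : ∀ (ts : List ℤ) p q → Unique ts → length p ≤ length ts → length q ≤ length ts →
    All (λ t → evalₚ t p ≡ evalₚ t q) ts → p ≈ₚ q
  ≈ₚ-by-evaluation ts p q unique p≤ts q≤ts agree = ≈ₚ-from-difference p q
    (vanishing⇒IsZeroₚ ts (p +ₚ -ₚ q) unique
      (length-+ₚ p (-ₚ q) p≤ts (subst (_≤ length ts) (sym (length-scaleₚ -1ℤ q)) q≤ts))
      (All.map difference-vanishes agree))
    where
    difference-vanishes : ∀ {t} → evalₚ t p ≡ evalₚ t q → evalₚ t (p +ₚ -ₚ q) ≡ 0ℤ
    difference-vanishes {t} eq = begin
      evalₚ t (p +ₚ -ₚ q)               ≡⟨ evalₚ-+ₚ t p (-ₚ q) ⟩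
      evalₚ t p + evalₚ t (-ₚ q)        ≡⟨ cong₂ _+_ eq (evalₚ-scaleₚ t -1ℤ q) ⟩
      evalₚ t q + -1ℤ * evalₚ t q       ≡⟨ ring (evalₚ t q) ⟩
      0ℤ                                ∎
      where
      ring : ∀ x → x + -1ℤ * x ≡ 0ℤ
      ring = solve-∀

module Cospectrality where

  open import Data.Bool using (Bool; true; false; T)
  open import Data.Bool.ListAction using (all)
  open import Data.Fin using (Fin)
  open import Data.Integer as ℤ using (ℤ; 1ℤ; -[1+_]; _*_; _^_)
  open import Data.Integer.Properties using (^-zeroˡ; *-identityˡ; -[1+-injective)
  open import Data.List using (List; []; _∷_; length; applyUpTo)
  open import Data.List.Properties using (length-applyUpTo)
  open import Data.List.Relation.Unary.All as All using (All)
  open import Data.List.Relation.Unary.All.Properties using (all⁺)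
  open import Data.List.Relation.Unary.Unique.Propositional using (Unique)
  open import Data.List.Relation.Unary.Unique.Propositional.Properties using (applyUpTo⁺₁)
  open import Data.Maybe using (Maybe; just)
  open import Data.Nat as ℕ using (_≤_)
  open import Data.Nat.Properties using (≤-trans; ≤-reflexive; <⇒≢; +-cancelˡ-≡)
  open import Data.Unit using (tt)
  open import Data.Vec using (Vec; tabulate; lookup; map)
  open import Data.Vec.Properties using (lookup∘tabulate; lookup-map)
  open import Relation.Nullary.Decidable using (⌊_⌋; toWitness)
  open Determinant
  open Bareiss
  open Polynomial
  open ≡-Reasoning

  private variable
    k n : ℕ

  characteristicMatrix : Adj n → Fin n → Fin n → Poly
  characteristicMatrix A i j = (X *ₚ δ i j) +ₚ (-ₚ (adjMatrix A i j ∷ []))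

  characteristicTable : Adj n → Vec (Vec Poly n) n
  characteristicTable A = tabulate λ i → tabulate λ j → characteristicMatrix A i j

  evalTable : ℤ → Vec (Vec Poly n) n → Vec (Vec ℤ n) n
  evalTable t = map (map (evalₚ t))

  evalTable-characteristic : (A : Adj n) (t : ℤ) →
    ∀ i j → evalₚ t (characteristicMatrix A i j) ≡ toMatrix (evalTable t (characteristicTable A)) i j
  evalTable-characteristic A t i j = sym (begin
    lookup (lookup (map (map (evalₚ t)) table) i) j
      ≡⟨ cong (λ row → lookup row j) (lookup-map i (map (evalₚ t)) table) ⟩
    lookup (map (evalₚ t) (lookup table i)) j
      ≡⟨ lookup-map j (evalₚ t) (lookup table i) ⟩
    evalₚ t (lookup (lookup table i) j)
      ≡⟨ cong (λ row → evalₚ t (lookup row j)) (lookup∘tabulate row i) ⟩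
    evalₚ t (lookup (row i) j)
      ≡⟨ cong (evalₚ t) (lookup∘tabulate (characteristicMatrix A i) j) ⟩
    evalₚ t (characteristicMatrix A i j) ∎)
    where
    row : Fin _ → Vec Poly _
    row i = tabulate (characteristicMatrix A i)
    table = tabulate row

  bareiss-charPoly : (A : Adj (suc k)) {t v : ℤ} → bareiss 1ℤ (evalTable t (characteristicTable A)) ≡ just v →
    evalₚ t (charPoly A) ≡ v
  bareiss-charPoly {k} A {t} {v} eq = begin
    evalₚ t (charPoly A)
      ≡⟨ evalₚ-det t (suc k) (characteristicMatrix A) ⟩
    detℤ (λ i j → evalₚ t (characteristicMatrix A i j))
      ≡⟨ detℤ-cong (evalTable-characteristic A t) ⟩
    detℤ (toMatrix (evalTable t (characteristicTable A)))
      ≡⟨ bareiss-sound 1ℤ (evalTable t (characteristicTable A)) eq ⟨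
    1ℤ ^ k * v
      ≡⟨ cong (_* v) (^-zeroˡ k) ⟩
    1ℤ * v
      ≡⟨ *-identityˡ v ⟩
    v ∎

  sameValue : Maybe ℤ → Maybe ℤ → Bool
  sameValue (just x) (just y) = ⌊ x ℤ.≟ y ⌋
  sameValue _        _        = false

  -- P and Q are passed as arguments so that their entries are computed once for all the points ts
  valuesAgree : List ℤ → (P Q : Vec (Vec Poly n) n) → Bool
  valuesAgree {zero}  ts P Q = false
  valuesAgree {suc k} ts P Q = all (λ t → sameValue (bareiss 1ℤ (evalTable t P)) (bareiss 1ℤ (evalTable t Q))) ts

  cospectral-by-evaluation : (A B : Adj n) (ts : List ℤ) → Unique ts → suc n ≤ length ts →
    valuesAgree ts (characteristicTable A) (characteristicTable B) ≡ true → Cospectral A B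
  cospectral-by-evaluation {suc k} A B ts unique enough agree =
    ≈ₚ-by-evaluation ts (charPoly A) (charPoly B) unique
      (≤-trans (length-charPoly A) enough) (≤-trans (length-charPoly B) enough)
      (All.map same-evaluation (all⁺ agreesAt ts (subst T (sym agree) tt)))
    where
    agreesAt : ℤ → Bool
    agreesAt t = sameValue (bareiss 1ℤ (evalTable t (characteristicTable A)))
                           (bareiss 1ℤ (evalTable t (characteristicTable B)))
    same-evaluation : ∀ {t} → T (agreesAt t) →
      evalₚ t (charPoly A) ≡ evalₚ t (charPoly B)
    same-evaluation {t} same with bareiss 1ℤ (evalTable t (characteristicTable A)) in eqA
                                | bareiss 1ℤ (evalTable t (characteristicTable B)) in eqB
    ... | just x | just y =
      trans (bareiss-charPoly A eqA) (trans (toWitness {a? = x ℤ.≟ y} same) (sym (bareiss-charPoly B eqB)))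

  -- −4, −5, …: below the smallest eigenvalue of the graphs considered (which exceeds −4), so that tI − A
  -- is negative definite and no pivot of the elimination vanishes.
  samplePoint : ℕ → ℤ
  samplePoint i = -[1+ 3 ℕ.+ i ]

  samplePoints : ℕ → List ℤ
  samplePoints = applyUpTo samplePoint

  cospectral-by-sampling : (A B : Adj n) →
    valuesAgree (samplePoints (suc n)) (characteristicTable A) (characteristicTable B) ≡ true → Cospectral A B
  cospectral-by-sampling {n} A B = cospectral-by-evaluation A B (samplePoints (suc n))
    (applyUpTo⁺₁ samplePoint (suc n) λ i<j _ eq → <⇒≢ i<j (+-cancelˡ-≡ 3 _ _ (-[1+-injective eq)))
    (≤-reflexive (sym (length-applyUpTo samplePoint (suc n))))

module CayleyTranslation where

  open import Data.Fin using (Fin; toℕ)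
  open import Data.Fin.Properties using (toℕ-injective; toℕ-fromℕ<; toℕ<n; toℕ≤n)
  open import Data.Nat as ℕ using (_+_; _∸_; _%_; _<_)
  open import Data.Nat.DivMod using (%-distribˡ-+; m%n%n≡m%n; [m+n]%n≡m%n; m<n⇒m%n≡m; m%n≤n; n%n≡0)
  open import Data.Nat.Properties using (+-assoc; +-comm; m+[n∸m]≡n; m∸n+n≡m)
  open ≡-Reasoning

  module _ (n : ℕ) .{{_ : NonZero n}} where

    private
      %-absorbˡ : ∀ a b → (a % n + b) % n ≡ (a + b) % n
      %-absorbˡ a b = begin
        (a % n + b) % n            ≡⟨ %-distribˡ-+ (a % n) b n ⟩
        (a % n % n + b % n) % n    ≡⟨ cong (λ z → (z + b % n) % n) (m%n%n≡m%n a n) ⟩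
        (a % n + b % n) % n        ≡⟨ %-distribˡ-+ a b n ⟨
        (a + b) % n                ∎

      %-absorbʳ : ∀ a b → (a + b % n) % n ≡ (a + b) % n
      %-absorbʳ a b = begin
        (a + b % n) % n   ≡⟨ cong (_% n) (+-comm a (b % n)) ⟩
        (b % n + a) % n   ≡⟨ %-absorbˡ b a ⟩
        (b + a) % n       ≡⟨ cong (_% n) (+-comm b a) ⟩
        (a + b) % n       ∎

      %-cancelʳ : ∀ {a b} k → a < n → b < n → (a + k) % n ≡ (b + k) % n → a ≡ b
      %-cancelʳ {a} {b} k a<n b<n eq = begin
        a                                ≡⟨ undo a<n ⟨
        ((a + k) % n + (n ∸ k % n)) % n  ≡⟨ cong (λ z → (z + (n ∸ k % n)) % n) eq ⟩
        ((b + k) % n + (n ∸ k % n)) % n  ≡⟨ undo b<n ⟩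
        b                                ∎
        where
        undo : ∀ {x} → x < n → ((x + k) % n + (n ∸ k % n)) % n ≡ x
        undo {x} x<n = begin
          ((x + k) % n + (n ∸ k % n)) % n   ≡⟨ %-absorbˡ (x + k) (n ∸ k % n) ⟩
          (x + k + (n ∸ k % n)) % n         ≡⟨ cong (_% n) (+-assoc x k (n ∸ k % n)) ⟩
          (x + (k + (n ∸ k % n))) % n       ≡⟨ %-absorbʳ x (k + (n ∸ k % n)) ⟨
          (x + (k + (n ∸ k % n)) % n) % n   ≡⟨ cong (λ z → (x + z) % n) (%-absorbˡ k (n ∸ k % n)) ⟨
          (x + (k % n + (n ∸ k % n)) % n) % n ≡⟨ cong (λ z → (x + z % n) % n) (m+[n∸m]≡n (m%n≤n k n)) ⟩
          (x + n % n) % n                   ≡⟨ %-absorbʳ x n ⟩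
          (x + n) % n                       ≡⟨ [m+n]%n≡m%n x n ⟩
          x % n                             ≡⟨ m<n⇒m%n≡m x<n ⟩
          x                                 ∎

      toℕ-subG : ∀ x y → toℕ (subG n x y) ≡ (toℕ x + (n ∸ toℕ y)) % n
      toℕ-subG x y = toℕ-fromℕ< _

      subG-+ : ∀ x y → (toℕ (subG n x y) + toℕ y) % n ≡ toℕ x
      subG-+ x y = begin
        (toℕ (subG n x y) + toℕ y) % n          ≡⟨ cong (λ z → (z + toℕ y) % n) (toℕ-subG x y) ⟩
        ((toℕ x + (n ∸ toℕ y)) % n + toℕ y) % n ≡⟨ %-absorbˡ (toℕ x + (n ∸ toℕ y)) (toℕ y) ⟩
        (toℕ x + (n ∸ toℕ y) + toℕ y) % n       ≡⟨ cong (_% n) (+-assoc (toℕ x) (n ∸ toℕ y) (toℕ y)) ⟩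
        (toℕ x + ((n ∸ toℕ y) + toℕ y)) % n     ≡⟨ cong (λ z → (toℕ x + z) % n) (m∸n+n≡m (toℕ≤n y)) ⟩
        (toℕ x + n) % n                         ≡⟨ [m+n]%n≡m%n (toℕ x) n ⟩
        toℕ x % n                               ≡⟨ m<n⇒m%n≡m (toℕ<n x) ⟩
        toℕ x                                   ∎

    subG-injectiveˡ : ∀ {x y} c → subG n x c ≡ subG n y c → x ≡ y
    subG-injectiveˡ {x} {y} c eq = toℕ-injective (%-cancelʳ (n ∸ toℕ c) (toℕ<n x) (toℕ<n y) (begin
      (toℕ x + (n ∸ toℕ c)) % n   ≡⟨ toℕ-subG x c ⟨
      toℕ (subG n x c)            ≡⟨ cong toℕ eq ⟩
      toℕ (subG n y c)            ≡⟨ toℕ-subG y c ⟩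
      (toℕ y + (n ∸ toℕ c)) % n   ∎))

    subG-self : ∀ c → subG n c c ≡ zeroG n
    subG-self c = toℕ-injective (begin
      toℕ (subG n c c)            ≡⟨ toℕ-subG c c ⟩
      (toℕ c + (n ∸ toℕ c)) % n   ≡⟨ cong (_% n) (m+[n∸m]≡n (toℕ≤n c)) ⟩
      n % n                       ≡⟨ n%n≡0 n ⟩
      0                           ≡⟨ m<n⇒m%n≡m (ℕ.>-nonZero⁻¹ n) ⟨
      0 % n                       ≡⟨ toℕ-fromℕ< _ ⟨
      toℕ (zeroG n)               ∎)

    subG-translate : ∀ x y c → subG n (subG n x c) (subG n y c) ≡ subG n x y
    subG-translate x y c = toℕ-injective (%-cancelʳ (V + toℕ c) (toℕ<n (subG n U′ V′)) (toℕ<n (subG n x y)) (begin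
      (L + (V + toℕ c)) % n        ≡⟨ cong (_% n) (+-assoc L V (toℕ c)) ⟨
      (L + V + toℕ c) % n          ≡⟨ %-absorbˡ (L + V) (toℕ c) ⟨
      ((L + V) % n + toℕ c) % n    ≡⟨ cong (λ z → (z + toℕ c) % n) (subG-+ U′ V′) ⟩
      (toℕ U′ + toℕ c) % n         ≡⟨ subG-+ x c ⟩
      toℕ x                        ≡⟨ subG-+ x y ⟨
      (R + toℕ y) % n              ≡⟨ cong (λ z → (R + z) % n) (subG-+ y c) ⟨
      (R + (V + toℕ c) % n) % n    ≡⟨ %-absorbʳ R (V + toℕ c) ⟩
      (R + (V + toℕ c)) % n        ∎))
      where
      U′ = subG n x c
      V′ = subG n y c
      V = toℕ V′
      L = toℕ (subG n U′ V′)
      R = toℕ (subG n x y)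

    Cay-translate : ∀ (S : ConnSet n) x y c → Cay n S x y ≡ Cay n S (subG n x c) (subG n y c)
    Cay-translate S x y c = cong (mem S) (sym (subG-translate x y c))


module InducedSubgraph where

  open import Data.Bool as Bool using (Bool)
  open import Data.Fin as Fin using (Fin)
  open import Data.Fin.Properties using (any?)
  open import Data.Product using (∃)
  open import Data.Unit using (⊤; tt)
  open import Data.Vec using (Vec; []; _∷_; map)
  open import Data.Vec.Relation.Binary.Pointwise.Inductive as Pointwise using (Pointwise; []; _∷_)
  open import Function using (Injective; _∘_)
  open import Function.Bundles using (Inverse)
  open import Relation.Nullary using (Dec; yes; ¬?)
  open import Relation.Nullary.Decidable using (_×-dec_)
  open CayleyTranslation

  private variable
    m n n′ : ℕ

  infixr 5 _▹_

  -- A graph on the vertices m, m + 1, …, each listed with its adjacency to the vertices before it,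
  -- the most recent first.
  data Pattern (m : ℕ) : Set where
    ∎   : Pattern m
    _▹_ : Vec Bool m → Pattern (suc m) → Pattern m

  module _ (A : Adj n) where

    Fits : Vec (Fin n) m → Vec Bool m → Fin n → Set
    Fits us r v = Pointwise (λ u b → A u v ≡ b × u ≢ v) us r

    Embeds : Pattern m → Vec (Fin n) m → Set
    Embeds ∎       us = ⊤
    Embeds (r ▹ P) us = ∃ λ v → Fits us r v × Embeds P (v ∷ us)

    embeds? : (P : Pattern m) (us : Vec (Fin n) m) → Dec (Embeds P us)
    embeds? ∎       us = yes tt
    embeds? (r ▹ P) us = any? λ v →
      Pointwise.decidable (λ u b → (A u v Bool.≟ b) ×-dec ¬? (u Fin.≟ v)) us r ×-dec embeds? P (v ∷ us)

  Embeds-map : {A : Adj n} {B : Adj n′} (f : Fin n → Fin n′) → Injective _≡_ _≡_ f →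
    (∀ x y → A x y ≡ B (f x) (f y)) → ∀ (P : Pattern m) us → Embeds A P us → Embeds B P (map f us)
  Embeds-map f f-inj f-hom ∎       us _                     = tt
  Embeds-map {A = A} {B} f f-inj f-hom (r ▹ P) us (v , fits , embeds) =
    f v , fits-map fits , Embeds-map f f-inj f-hom P (v ∷ us) embeds
    where
    fits-map : ∀ {m} {us : Vec _ m} {r} → Fits A us r v → Fits B (map f us) r (f v)
    fits-map []                   = []
    fits-map ((adj , u≢v) ∷ fits) = (trans (sym (f-hom _ v)) adj , u≢v ∘ f-inj) ∷ fits-map fits

  Embeds-Isomorphic : {A : Adj n} {B : Adj n′} → Isomorphic A B → (P : Pattern 0) →
    Embeds B P [] → Embeds A P []
  Embeds-Isomorphic {A = A} {B} (f , f-hom) P = Embeds-map from from-injective from-hom P []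
    where
    open Inverse f
    from-injective : Injective _≡_ _≡_ from
    from-injective {x} {y} eq = trans (sym (strictlyInverseˡ x)) (trans (cong to eq) (strictlyInverseˡ y))
    from-hom : ∀ x y → B x y ≡ A (from x) (from y)
    from-hom x y = sym (trans (f-hom (from x) (from y)) (cong₂ B (strictlyInverseˡ x) (strictlyInverseˡ y)))

  Embeds-Cay-at-zero : ∀ n .{{_ : NonZero n}} (S : ConnSet n) (P : Pattern 1) →
    Embeds (Cay n S) ([] ▹ P) [] → Embeds (Cay n S) P (zeroG n ∷ [])
  Embeds-Cay-at-zero n S P (v , [] , embeds) =
    subst (λ u → Embeds (Cay n S) P (u ∷ [])) (subG-self n v)
      (Embeds-map (λ x → subG n x v) (subG-injectiveˡ n v) (λ x y → Cay-translate n S x y v) P (v ∷ []) embeds)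

module PaleyGraphs where

  open import Data.Bool as Bool using (Bool; true; false)
  open import Data.Bool.ListAction using (any)
  open import Data.Fin using (Fin; toℕ)
  open import Data.Fin.Properties using (all?)
  open import Data.List using (List; []; _∷_)
  open import Data.Nat using (_≡ᵇ_; _^_; _∸_; _/_; _%_)
  open import Data.Vec using (Vec; []; _∷_; lookup)
  open import Relation.Nullary using (Dec; does; proof)
  open import Relation.Nullary.Decidable using (_×-dec_)
  open import Relation.Nullary.Reflects using (Reflects; invert)
  open Cospectrality
  open InducedSubgraph

  private variable
    n : ℕ

  from-true : ∀ {P : Set} (P? : Dec P) → does P? ≡ true → P
  from-true P? eq = invert (subst (Reflects _) eq (proof P?))

  from-false : ∀ {P : Set} (P? : Dec P) → does P? ≡ false → ¬ P
  from-false P? eq = invert (subst (Reflects _) eq (proof P?))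

  -- Euler's criterion: for an odd prime p these are the nonzero squares, so Cay p (paley p _ _) is the
  -- Paley graph.
  isQuadraticResidue : ∀ p .{{_ : NonZero p}} → Fin p → Bool
  isQuadraticResidue p x = (toℕ x ^ ((p ∸ 1) / 2)) % p ≡ᵇ 1

  paley : ∀ p .{{_ : NonZero p}} → isQuadraticResidue p (zeroG p) ≡ false →
    does (all? λ x → isQuadraticResidue p (invG p x) Bool.≟ isQuadraticResidue p x) ≡ true → ConnSet p
  paley p 0∉ symmetric = record
    { mem = isQuadraticResidue p ; noIdent = 0∉ ; inverseCl = from-true (all? _) symmetric }

  fromNeighbours : Vec (List ℕ) n → Adj n
  fromNeighbours N i j = any (toℕ j ≡ᵇ_) (lookup N i)

  isSimple? : (A : Adj n) → Dec (IsSimple A)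
  isSimple? A = all? (λ i → all? λ j → A i j Bool.≟ A j i) ×-dec all? (λ i → A i i Bool.≟ false)

  graph : (A : Adj n) → does (isSimple? A) ≡ true → Graph n
  graph A simple = record { adj = A ; simple = from-true (isSimple? A) simple }

  ¬IsDS-by-pattern : .{{_ : NonZero n}} (S : ConnSet n) (Γ : Graph n) (P : Pattern 1) →
    Cospectral (Cay n S) (adj Γ) →
    does (embeds? (Cay n S) P (zeroG n ∷ [])) ≡ false → does (embeds? (adj Γ) ([] ▹ P) []) ≡ true →
    ¬ IsDS n
  ¬IsDS-by-pattern {n} S Γ P cospectral ¬P-in-Cay P-in-Γ isDS =
    from-false (embeds? (Cay n S) P (zeroG n ∷ [])) ¬P-in-Cay
      (Embeds-Cay-at-zero n S P (Embeds-Isomorphic (isDS S n Γ cospectral) ([] ▹ P)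
        (from-true (embeds? (adj Γ) ([] ▹ P) []) P-in-Γ)))

  -- K₅ and K₆ minus an edge, each listed after its first vertex
  K₅ K₆⁻ : Pattern 1
  K₅  = (true ∷ []) ▹ (true ∷ true ∷ []) ▹ (true ∷ true ∷ true ∷ []) ▹ (true ∷ true ∷ true ∷ true ∷ []) ▹ ∎
  K₆⁻ = (true ∷ []) ▹ (true ∷ true ∷ []) ▹ (true ∷ true ∷ true ∷ []) ▹ (true ∷ true ∷ true ∷ true ∷ [])
      ▹ (false ∷ true ∷ true ∷ true ∷ true ∷ []) ▹ ∎

  -- Strongly regular graphs with the parameters of the Paley graphs on 29, 37 and 41 vertices.
  neighbours₂₉ : Vec (List ℕ) 29
  neighbours₂₉ =
    ( (8 ∷ 10 ∷ 11 ∷ 13 ∷ 14 ∷ 16 ∷ 17 ∷ 19 ∷ 20 ∷ 22 ∷ 23 ∷ 25 ∷ 26 ∷ 28 ∷ [])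
    ∷ (9 ∷ 10 ∷ 12 ∷ 13 ∷ 15 ∷ 16 ∷ 18 ∷ 19 ∷ 21 ∷ 22 ∷ 24 ∷ 25 ∷ 27 ∷ 28 ∷ [])
    ∷ (6 ∷ 7 ∷ 9 ∷ 12 ∷ 14 ∷ 17 ∷ 20 ∷ 21 ∷ 22 ∷ 23 ∷ 24 ∷ 25 ∷ 26 ∷ 27 ∷ [])
    ∷ (5 ∷ 7 ∷ 8 ∷ 11 ∷ 14 ∷ 15 ∷ 16 ∷ 17 ∷ 18 ∷ 19 ∷ 21 ∷ 24 ∷ 26 ∷ 27 ∷ [])
    ∷ (5 ∷ 6 ∷ 8 ∷ 9 ∷ 10 ∷ 11 ∷ 12 ∷ 13 ∷ 15 ∷ 18 ∷ 20 ∷ 23 ∷ 26 ∷ 27 ∷ [])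
    ∷ (3 ∷ 4 ∷ 6 ∷ 7 ∷ 11 ∷ 12 ∷ 13 ∷ 15 ∷ 17 ∷ 19 ∷ 21 ∷ 22 ∷ 23 ∷ 28 ∷ [])
    ∷ (2 ∷ 4 ∷ 5 ∷ 7 ∷ 8 ∷ 10 ∷ 12 ∷ 14 ∷ 18 ∷ 19 ∷ 23 ∷ 24 ∷ 25 ∷ 28 ∷ [])
    ∷ (2 ∷ 3 ∷ 5 ∷ 6 ∷ 9 ∷ 10 ∷ 11 ∷ 14 ∷ 15 ∷ 16 ∷ 20 ∷ 22 ∷ 24 ∷ 28 ∷ [])
    ∷ (0 ∷ 3 ∷ 4 ∷ 6 ∷ 10 ∷ 15 ∷ 16 ∷ 17 ∷ 18 ∷ 20 ∷ 21 ∷ 23 ∷ 24 ∷ 25 ∷ [])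
    ∷ (1 ∷ 2 ∷ 4 ∷ 7 ∷ 10 ∷ 11 ∷ 13 ∷ 17 ∷ 18 ∷ 20 ∷ 21 ∷ 24 ∷ 26 ∷ 28 ∷ [])
    ∷ (0 ∷ 1 ∷ 4 ∷ 6 ∷ 7 ∷ 8 ∷ 9 ∷ 11 ∷ 15 ∷ 19 ∷ 22 ∷ 24 ∷ 25 ∷ 26 ∷ [])
    ∷ (0 ∷ 3 ∷ 4 ∷ 5 ∷ 7 ∷ 9 ∷ 10 ∷ 12 ∷ 16 ∷ 17 ∷ 25 ∷ 26 ∷ 27 ∷ 28 ∷ [])
    ∷ (1 ∷ 2 ∷ 4 ∷ 5 ∷ 6 ∷ 11 ∷ 16 ∷ 17 ∷ 18 ∷ 19 ∷ 20 ∷ 22 ∷ 25 ∷ 27 ∷ [])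
    ∷ (0 ∷ 1 ∷ 4 ∷ 5 ∷ 9 ∷ 14 ∷ 15 ∷ 17 ∷ 19 ∷ 20 ∷ 23 ∷ 24 ∷ 27 ∷ 28 ∷ [])
    ∷ (0 ∷ 2 ∷ 3 ∷ 6 ∷ 7 ∷ 13 ∷ 15 ∷ 18 ∷ 19 ∷ 20 ∷ 25 ∷ 26 ∷ 27 ∷ 28 ∷ [])
    ∷ (1 ∷ 3 ∷ 4 ∷ 5 ∷ 7 ∷ 8 ∷ 10 ∷ 13 ∷ 14 ∷ 20 ∷ 21 ∷ 22 ∷ 25 ∷ 27 ∷ [])
    ∷ (0 ∷ 1 ∷ 3 ∷ 7 ∷ 8 ∷ 11 ∷ 12 ∷ 18 ∷ 20 ∷ 22 ∷ 23 ∷ 24 ∷ 27 ∷ 28 ∷ [])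
    ∷ (0 ∷ 2 ∷ 3 ∷ 5 ∷ 8 ∷ 9 ∷ 11 ∷ 12 ∷ 13 ∷ 19 ∷ 20 ∷ 21 ∷ 24 ∷ 25 ∷ [])
    ∷ (1 ∷ 3 ∷ 4 ∷ 6 ∷ 8 ∷ 9 ∷ 12 ∷ 14 ∷ 16 ∷ 19 ∷ 20 ∷ 21 ∷ 26 ∷ 28 ∷ [])
    ∷ (0 ∷ 1 ∷ 3 ∷ 5 ∷ 6 ∷ 10 ∷ 12 ∷ 13 ∷ 14 ∷ 17 ∷ 18 ∷ 22 ∷ 24 ∷ 26 ∷ [])
    ∷ (0 ∷ 2 ∷ 4 ∷ 7 ∷ 8 ∷ 9 ∷ 12 ∷ 13 ∷ 14 ∷ 15 ∷ 16 ∷ 17 ∷ 18 ∷ 22 ∷ [])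
    ∷ (1 ∷ 2 ∷ 3 ∷ 5 ∷ 8 ∷ 9 ∷ 15 ∷ 17 ∷ 18 ∷ 22 ∷ 23 ∷ 25 ∷ 26 ∷ 28 ∷ [])
    ∷ (0 ∷ 1 ∷ 2 ∷ 5 ∷ 7 ∷ 10 ∷ 12 ∷ 15 ∷ 16 ∷ 19 ∷ 20 ∷ 21 ∷ 23 ∷ 26 ∷ [])
    ∷ (0 ∷ 2 ∷ 4 ∷ 5 ∷ 6 ∷ 8 ∷ 13 ∷ 16 ∷ 21 ∷ 22 ∷ 24 ∷ 26 ∷ 27 ∷ 28 ∷ [])
    ∷ (1 ∷ 2 ∷ 3 ∷ 6 ∷ 7 ∷ 8 ∷ 9 ∷ 10 ∷ 13 ∷ 16 ∷ 17 ∷ 19 ∷ 23 ∷ 27 ∷ [])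
    ∷ (0 ∷ 1 ∷ 2 ∷ 6 ∷ 8 ∷ 10 ∷ 11 ∷ 12 ∷ 14 ∷ 15 ∷ 17 ∷ 21 ∷ 27 ∷ 28 ∷ [])
    ∷ (0 ∷ 2 ∷ 3 ∷ 4 ∷ 9 ∷ 10 ∷ 11 ∷ 14 ∷ 18 ∷ 19 ∷ 21 ∷ 22 ∷ 23 ∷ 27 ∷ [])
    ∷ (1 ∷ 2 ∷ 3 ∷ 4 ∷ 11 ∷ 12 ∷ 13 ∷ 14 ∷ 15 ∷ 16 ∷ 23 ∷ 24 ∷ 25 ∷ 26 ∷ [])
    ∷ (0 ∷ 1 ∷ 5 ∷ 6 ∷ 7 ∷ 9 ∷ 11 ∷ 13 ∷ 14 ∷ 16 ∷ 18 ∷ 21 ∷ 23 ∷ 25 ∷ [])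
    ∷ [])

  neighbours₃₇ : Vec (List ℕ) 37
  neighbours₃₇ =
    ( (1 ∷ 2 ∷ 3 ∷ 4 ∷ 5 ∷ 6 ∷ 7 ∷ 8 ∷ 9 ∷ 10 ∷ 11 ∷ 12 ∷ 13 ∷ 14 ∷ 15 ∷ 16 ∷ 17 ∷ 18 ∷ [])
    ∷ (0 ∷ 4 ∷ 5 ∷ 6 ∷ 7 ∷ 10 ∷ 11 ∷ 13 ∷ 16 ∷ 19 ∷ 21 ∷ 23 ∷ 28 ∷ 29 ∷ 30 ∷ 32 ∷ 33 ∷ 34 ∷ [])
    ∷ (0 ∷ 5 ∷ 6 ∷ 7 ∷ 8 ∷ 11 ∷ 12 ∷ 14 ∷ 17 ∷ 20 ∷ 22 ∷ 24 ∷ 29 ∷ 30 ∷ 31 ∷ 33 ∷ 34 ∷ 35 ∷ [])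
    ∷ (0 ∷ 6 ∷ 7 ∷ 8 ∷ 9 ∷ 12 ∷ 13 ∷ 15 ∷ 18 ∷ 21 ∷ 23 ∷ 25 ∷ 30 ∷ 31 ∷ 32 ∷ 34 ∷ 35 ∷ 36 ∷ [])
    ∷ (0 ∷ 1 ∷ 7 ∷ 8 ∷ 9 ∷ 10 ∷ 13 ∷ 14 ∷ 16 ∷ 22 ∷ 24 ∷ 26 ∷ 28 ∷ 31 ∷ 32 ∷ 33 ∷ 35 ∷ 36 ∷ [])
    ∷ (0 ∷ 1 ∷ 2 ∷ 8 ∷ 9 ∷ 11 ∷ 14 ∷ 15 ∷ 17 ∷ 23 ∷ 25 ∷ 27 ∷ 28 ∷ 29 ∷ 32 ∷ 33 ∷ 34 ∷ 36 ∷ [])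
    ∷ (0 ∷ 1 ∷ 2 ∷ 3 ∷ 9 ∷ 12 ∷ 15 ∷ 16 ∷ 18 ∷ 19 ∷ 24 ∷ 26 ∷ 28 ∷ 29 ∷ 30 ∷ 33 ∷ 34 ∷ 35 ∷ [])
    ∷ (0 ∷ 1 ∷ 2 ∷ 3 ∷ 4 ∷ 10 ∷ 13 ∷ 16 ∷ 17 ∷ 20 ∷ 25 ∷ 27 ∷ 29 ∷ 30 ∷ 31 ∷ 34 ∷ 35 ∷ 36 ∷ [])
    ∷ (0 ∷ 2 ∷ 3 ∷ 4 ∷ 5 ∷ 11 ∷ 14 ∷ 17 ∷ 18 ∷ 19 ∷ 21 ∷ 26 ∷ 28 ∷ 30 ∷ 31 ∷ 32 ∷ 35 ∷ 36 ∷ [])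
    ∷ (0 ∷ 3 ∷ 4 ∷ 5 ∷ 6 ∷ 10 ∷ 12 ∷ 15 ∷ 18 ∷ 20 ∷ 22 ∷ 27 ∷ 28 ∷ 29 ∷ 31 ∷ 32 ∷ 33 ∷ 36 ∷ [])
    ∷ (0 ∷ 1 ∷ 4 ∷ 7 ∷ 9 ∷ 12 ∷ 14 ∷ 15 ∷ 17 ∷ 19 ∷ 21 ∷ 22 ∷ 23 ∷ 26 ∷ 27 ∷ 29 ∷ 30 ∷ 31 ∷ [])
    ∷ (0 ∷ 1 ∷ 2 ∷ 5 ∷ 8 ∷ 13 ∷ 15 ∷ 16 ∷ 18 ∷ 19 ∷ 20 ∷ 22 ∷ 23 ∷ 24 ∷ 27 ∷ 30 ∷ 31 ∷ 32 ∷ [])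
    ∷ (0 ∷ 2 ∷ 3 ∷ 6 ∷ 9 ∷ 10 ∷ 14 ∷ 16 ∷ 17 ∷ 19 ∷ 20 ∷ 21 ∷ 23 ∷ 24 ∷ 25 ∷ 31 ∷ 32 ∷ 33 ∷ [])
    ∷ (0 ∷ 1 ∷ 3 ∷ 4 ∷ 7 ∷ 11 ∷ 15 ∷ 17 ∷ 18 ∷ 20 ∷ 21 ∷ 22 ∷ 24 ∷ 25 ∷ 26 ∷ 32 ∷ 33 ∷ 34 ∷ [])
    ∷ (0 ∷ 2 ∷ 4 ∷ 5 ∷ 8 ∷ 10 ∷ 12 ∷ 16 ∷ 18 ∷ 21 ∷ 22 ∷ 23 ∷ 25 ∷ 26 ∷ 27 ∷ 33 ∷ 34 ∷ 35 ∷ [])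
    ∷ (0 ∷ 3 ∷ 5 ∷ 6 ∷ 9 ∷ 10 ∷ 11 ∷ 13 ∷ 17 ∷ 19 ∷ 22 ∷ 23 ∷ 24 ∷ 26 ∷ 27 ∷ 34 ∷ 35 ∷ 36 ∷ [])
    ∷ (0 ∷ 1 ∷ 4 ∷ 6 ∷ 7 ∷ 11 ∷ 12 ∷ 14 ∷ 18 ∷ 19 ∷ 20 ∷ 23 ∷ 24 ∷ 25 ∷ 27 ∷ 28 ∷ 35 ∷ 36 ∷ [])
    ∷ (0 ∷ 2 ∷ 5 ∷ 7 ∷ 8 ∷ 10 ∷ 12 ∷ 13 ∷ 15 ∷ 19 ∷ 20 ∷ 21 ∷ 24 ∷ 25 ∷ 26 ∷ 28 ∷ 29 ∷ 36 ∷ [])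
    ∷ (0 ∷ 3 ∷ 6 ∷ 8 ∷ 9 ∷ 11 ∷ 13 ∷ 14 ∷ 16 ∷ 20 ∷ 21 ∷ 22 ∷ 25 ∷ 26 ∷ 27 ∷ 28 ∷ 29 ∷ 30 ∷ [])
    ∷ (1 ∷ 6 ∷ 8 ∷ 10 ∷ 11 ∷ 12 ∷ 15 ∷ 16 ∷ 17 ∷ 20 ∷ 21 ∷ 26 ∷ 27 ∷ 28 ∷ 31 ∷ 32 ∷ 34 ∷ 35 ∷ [])
    ∷ (2 ∷ 7 ∷ 9 ∷ 11 ∷ 12 ∷ 13 ∷ 16 ∷ 17 ∷ 18 ∷ 19 ∷ 21 ∷ 22 ∷ 27 ∷ 29 ∷ 32 ∷ 33 ∷ 35 ∷ 36 ∷ [])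
    ∷ (1 ∷ 3 ∷ 8 ∷ 10 ∷ 12 ∷ 13 ∷ 14 ∷ 17 ∷ 18 ∷ 19 ∷ 20 ∷ 22 ∷ 23 ∷ 28 ∷ 30 ∷ 33 ∷ 34 ∷ 36 ∷ [])
    ∷ (2 ∷ 4 ∷ 9 ∷ 10 ∷ 11 ∷ 13 ∷ 14 ∷ 15 ∷ 18 ∷ 20 ∷ 21 ∷ 23 ∷ 24 ∷ 28 ∷ 29 ∷ 31 ∷ 34 ∷ 35 ∷ [])
    ∷ (1 ∷ 3 ∷ 5 ∷ 10 ∷ 11 ∷ 12 ∷ 14 ∷ 15 ∷ 16 ∷ 21 ∷ 22 ∷ 24 ∷ 25 ∷ 29 ∷ 30 ∷ 32 ∷ 35 ∷ 36 ∷ [])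
    ∷ (2 ∷ 4 ∷ 6 ∷ 11 ∷ 12 ∷ 13 ∷ 15 ∷ 16 ∷ 17 ∷ 22 ∷ 23 ∷ 25 ∷ 26 ∷ 28 ∷ 30 ∷ 31 ∷ 33 ∷ 36 ∷ [])
    ∷ (3 ∷ 5 ∷ 7 ∷ 12 ∷ 13 ∷ 14 ∷ 16 ∷ 17 ∷ 18 ∷ 23 ∷ 24 ∷ 26 ∷ 27 ∷ 28 ∷ 29 ∷ 31 ∷ 32 ∷ 34 ∷ [])
    ∷ (4 ∷ 6 ∷ 8 ∷ 10 ∷ 13 ∷ 14 ∷ 15 ∷ 17 ∷ 18 ∷ 19 ∷ 24 ∷ 25 ∷ 27 ∷ 29 ∷ 30 ∷ 32 ∷ 33 ∷ 35 ∷ [])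
    ∷ (5 ∷ 7 ∷ 9 ∷ 10 ∷ 11 ∷ 14 ∷ 15 ∷ 16 ∷ 18 ∷ 19 ∷ 20 ∷ 25 ∷ 26 ∷ 30 ∷ 31 ∷ 33 ∷ 34 ∷ 36 ∷ [])
    ∷ (1 ∷ 4 ∷ 5 ∷ 6 ∷ 8 ∷ 9 ∷ 16 ∷ 17 ∷ 18 ∷ 19 ∷ 21 ∷ 22 ∷ 24 ∷ 25 ∷ 29 ∷ 31 ∷ 34 ∷ 36 ∷ [])
    ∷ (1 ∷ 2 ∷ 5 ∷ 6 ∷ 7 ∷ 9 ∷ 10 ∷ 17 ∷ 18 ∷ 20 ∷ 22 ∷ 23 ∷ 25 ∷ 26 ∷ 28 ∷ 30 ∷ 32 ∷ 35 ∷ [])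
    ∷ (1 ∷ 2 ∷ 3 ∷ 6 ∷ 7 ∷ 8 ∷ 10 ∷ 11 ∷ 18 ∷ 21 ∷ 23 ∷ 24 ∷ 26 ∷ 27 ∷ 29 ∷ 31 ∷ 33 ∷ 36 ∷ [])
    ∷ (2 ∷ 3 ∷ 4 ∷ 7 ∷ 8 ∷ 9 ∷ 10 ∷ 11 ∷ 12 ∷ 19 ∷ 22 ∷ 24 ∷ 25 ∷ 27 ∷ 28 ∷ 30 ∷ 32 ∷ 34 ∷ [])
    ∷ (1 ∷ 3 ∷ 4 ∷ 5 ∷ 8 ∷ 9 ∷ 11 ∷ 12 ∷ 13 ∷ 19 ∷ 20 ∷ 23 ∷ 25 ∷ 26 ∷ 29 ∷ 31 ∷ 33 ∷ 35 ∷ [])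
    ∷ (1 ∷ 2 ∷ 4 ∷ 5 ∷ 6 ∷ 9 ∷ 12 ∷ 13 ∷ 14 ∷ 20 ∷ 21 ∷ 24 ∷ 26 ∷ 27 ∷ 30 ∷ 32 ∷ 34 ∷ 36 ∷ [])
    ∷ (1 ∷ 2 ∷ 3 ∷ 5 ∷ 6 ∷ 7 ∷ 13 ∷ 14 ∷ 15 ∷ 19 ∷ 21 ∷ 22 ∷ 25 ∷ 27 ∷ 28 ∷ 31 ∷ 33 ∷ 35 ∷ [])
    ∷ (2 ∷ 3 ∷ 4 ∷ 6 ∷ 7 ∷ 8 ∷ 14 ∷ 15 ∷ 16 ∷ 19 ∷ 20 ∷ 22 ∷ 23 ∷ 26 ∷ 29 ∷ 32 ∷ 34 ∷ 36 ∷ [])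
    ∷ (3 ∷ 4 ∷ 5 ∷ 7 ∷ 8 ∷ 9 ∷ 15 ∷ 16 ∷ 17 ∷ 20 ∷ 21 ∷ 23 ∷ 24 ∷ 27 ∷ 28 ∷ 30 ∷ 33 ∷ 35 ∷ [])
    ∷ [])

  neighbours₄₁ : Vec (List ℕ) 41
  neighbours₄₁ =
    ( (6 ∷ 10 ∷ 13 ∷ 16 ∷ 17 ∷ 18 ∷ 20 ∷ 23 ∷ 24 ∷ 25 ∷ 27 ∷ 29 ∷ 30 ∷ 32 ∷ 34 ∷ 36 ∷ 37 ∷ 38 ∷ 39 ∷ 40 ∷ [])
    ∷ (6 ∷ 7 ∷ 10 ∷ 11 ∷ 13 ∷ 14 ∷ 16 ∷ 19 ∷ 20 ∷ 21 ∷ 23 ∷ 26 ∷ 27 ∷ 28 ∷ 29 ∷ 31 ∷ 32 ∷ 33 ∷ 35 ∷ 36 ∷ [])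
    ∷ (6 ∷ 7 ∷ 8 ∷ 10 ∷ 11 ∷ 12 ∷ 14 ∷ 15 ∷ 16 ∷ 18 ∷ 21 ∷ 22 ∷ 23 ∷ 25 ∷ 28 ∷ 33 ∷ 34 ∷ 38 ∷ 39 ∷ 40 ∷ [])
    ∷ (7 ∷ 8 ∷ 9 ∷ 10 ∷ 11 ∷ 12 ∷ 13 ∷ 15 ∷ 18 ∷ 19 ∷ 20 ∷ 22 ∷ 25 ∷ 26 ∷ 30 ∷ 32 ∷ 35 ∷ 36 ∷ 37 ∷ 38 ∷ [])
    ∷ (8 ∷ 9 ∷ 11 ∷ 12 ∷ 14 ∷ 17 ∷ 18 ∷ 19 ∷ 21 ∷ 24 ∷ 25 ∷ 26 ∷ 27 ∷ 29 ∷ 30 ∷ 31 ∷ 32 ∷ 33 ∷ 34 ∷ 40 ∷ [])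
    ∷ (9 ∷ 12 ∷ 15 ∷ 16 ∷ 17 ∷ 19 ∷ 22 ∷ 23 ∷ 24 ∷ 26 ∷ 28 ∷ 29 ∷ 31 ∷ 33 ∷ 35 ∷ 36 ∷ 37 ∷ 38 ∷ 39 ∷ 40 ∷ [])
    ∷ (0 ∷ 1 ∷ 2 ∷ 9 ∷ 11 ∷ 12 ∷ 13 ∷ 19 ∷ 20 ∷ 21 ∷ 22 ∷ 23 ∷ 24 ∷ 27 ∷ 28 ∷ 30 ∷ 33 ∷ 34 ∷ 37 ∷ 38 ∷ [])
    ∷ (1 ∷ 2 ∷ 3 ∷ 12 ∷ 14 ∷ 16 ∷ 17 ∷ 18 ∷ 20 ∷ 21 ∷ 22 ∷ 28 ∷ 30 ∷ 31 ∷ 32 ∷ 34 ∷ 35 ∷ 36 ∷ 37 ∷ 40 ∷ [])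
    ∷ (2 ∷ 3 ∷ 4 ∷ 10 ∷ 13 ∷ 15 ∷ 16 ∷ 19 ∷ 20 ∷ 21 ∷ 22 ∷ 24 ∷ 25 ∷ 27 ∷ 30 ∷ 31 ∷ 33 ∷ 35 ∷ 39 ∷ 40 ∷ [])
    ∷ (3 ∷ 4 ∷ 5 ∷ 6 ∷ 10 ∷ 11 ∷ 14 ∷ 18 ∷ 20 ∷ 21 ∷ 22 ∷ 24 ∷ 26 ∷ 28 ∷ 29 ∷ 30 ∷ 31 ∷ 37 ∷ 38 ∷ 39 ∷ [])
    ∷ (0 ∷ 1 ∷ 2 ∷ 3 ∷ 8 ∷ 9 ∷ 14 ∷ 20 ∷ 23 ∷ 25 ∷ 26 ∷ 28 ∷ 29 ∷ 30 ∷ 32 ∷ 33 ∷ 35 ∷ 38 ∷ 39 ∷ 40 ∷ [])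
    ∷ (1 ∷ 2 ∷ 3 ∷ 4 ∷ 6 ∷ 9 ∷ 13 ∷ 15 ∷ 16 ∷ 17 ∷ 18 ∷ 21 ∷ 23 ∷ 25 ∷ 26 ∷ 31 ∷ 32 ∷ 33 ∷ 37 ∷ 38 ∷ [])
    ∷ (2 ∷ 3 ∷ 4 ∷ 5 ∷ 6 ∷ 7 ∷ 13 ∷ 14 ∷ 19 ∷ 22 ∷ 23 ∷ 25 ∷ 26 ∷ 29 ∷ 30 ∷ 33 ∷ 34 ∷ 36 ∷ 37 ∷ 40 ∷ [])
    ∷ (0 ∷ 1 ∷ 3 ∷ 6 ∷ 8 ∷ 11 ∷ 12 ∷ 14 ∷ 15 ∷ 17 ∷ 20 ∷ 22 ∷ 25 ∷ 27 ∷ 29 ∷ 31 ∷ 33 ∷ 36 ∷ 37 ∷ 39 ∷ [])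
    ∷ (1 ∷ 2 ∷ 4 ∷ 7 ∷ 9 ∷ 10 ∷ 12 ∷ 13 ∷ 15 ∷ 17 ∷ 20 ∷ 21 ∷ 24 ∷ 25 ∷ 26 ∷ 28 ∷ 29 ∷ 34 ∷ 36 ∷ 39 ∷ [])
    ∷ (2 ∷ 3 ∷ 5 ∷ 8 ∷ 11 ∷ 13 ∷ 14 ∷ 17 ∷ 21 ∷ 22 ∷ 23 ∷ 24 ∷ 26 ∷ 27 ∷ 32 ∷ 34 ∷ 35 ∷ 36 ∷ 38 ∷ 39 ∷ [])
    ∷ (0 ∷ 1 ∷ 2 ∷ 5 ∷ 7 ∷ 8 ∷ 11 ∷ 18 ∷ 19 ∷ 20 ∷ 21 ∷ 23 ∷ 24 ∷ 25 ∷ 26 ∷ 31 ∷ 36 ∷ 37 ∷ 39 ∷ 40 ∷ [])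
    ∷ (0 ∷ 4 ∷ 5 ∷ 7 ∷ 11 ∷ 13 ∷ 14 ∷ 15 ∷ 20 ∷ 24 ∷ 25 ∷ 28 ∷ 31 ∷ 32 ∷ 33 ∷ 34 ∷ 35 ∷ 37 ∷ 38 ∷ 40 ∷ [])
    ∷ (0 ∷ 2 ∷ 3 ∷ 4 ∷ 7 ∷ 9 ∷ 11 ∷ 16 ∷ 19 ∷ 22 ∷ 25 ∷ 27 ∷ 28 ∷ 29 ∷ 31 ∷ 32 ∷ 34 ∷ 36 ∷ 38 ∷ 39 ∷ [])
    ∷ (1 ∷ 3 ∷ 4 ∷ 5 ∷ 6 ∷ 8 ∷ 12 ∷ 16 ∷ 18 ∷ 20 ∷ 24 ∷ 25 ∷ 26 ∷ 27 ∷ 28 ∷ 33 ∷ 34 ∷ 35 ∷ 36 ∷ 38 ∷ [])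
    ∷ (0 ∷ 1 ∷ 3 ∷ 6 ∷ 7 ∷ 8 ∷ 9 ∷ 10 ∷ 13 ∷ 14 ∷ 16 ∷ 17 ∷ 19 ∷ 22 ∷ 24 ∷ 26 ∷ 31 ∷ 34 ∷ 38 ∷ 40 ∷ [])
    ∷ (1 ∷ 2 ∷ 4 ∷ 6 ∷ 7 ∷ 8 ∷ 9 ∷ 11 ∷ 14 ∷ 15 ∷ 16 ∷ 24 ∷ 27 ∷ 29 ∷ 30 ∷ 35 ∷ 36 ∷ 37 ∷ 38 ∷ 40 ∷ [])
    ∷ (2 ∷ 3 ∷ 5 ∷ 6 ∷ 7 ∷ 8 ∷ 9 ∷ 12 ∷ 13 ∷ 15 ∷ 18 ∷ 20 ∷ 23 ∷ 24 ∷ 27 ∷ 28 ∷ 29 ∷ 31 ∷ 32 ∷ 40 ∷ [])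
    ∷ (0 ∷ 1 ∷ 2 ∷ 5 ∷ 6 ∷ 10 ∷ 11 ∷ 12 ∷ 15 ∷ 16 ∷ 22 ∷ 24 ∷ 25 ∷ 26 ∷ 29 ∷ 30 ∷ 31 ∷ 32 ∷ 34 ∷ 35 ∷ [])
    ∷ (0 ∷ 4 ∷ 5 ∷ 6 ∷ 8 ∷ 9 ∷ 14 ∷ 15 ∷ 16 ∷ 17 ∷ 19 ∷ 20 ∷ 21 ∷ 22 ∷ 23 ∷ 25 ∷ 28 ∷ 30 ∷ 32 ∷ 36 ∷ [])
    ∷ (0 ∷ 2 ∷ 3 ∷ 4 ∷ 8 ∷ 10 ∷ 11 ∷ 12 ∷ 13 ∷ 14 ∷ 16 ∷ 17 ∷ 18 ∷ 19 ∷ 23 ∷ 24 ∷ 28 ∷ 29 ∷ 35 ∷ 37 ∷ [])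
    ∷ (1 ∷ 3 ∷ 4 ∷ 5 ∷ 9 ∷ 10 ∷ 11 ∷ 12 ∷ 14 ∷ 15 ∷ 16 ∷ 19 ∷ 20 ∷ 23 ∷ 27 ∷ 32 ∷ 34 ∷ 37 ∷ 39 ∷ 40 ∷ [])
    ∷ (0 ∷ 1 ∷ 4 ∷ 6 ∷ 8 ∷ 13 ∷ 15 ∷ 18 ∷ 19 ∷ 21 ∷ 22 ∷ 26 ∷ 28 ∷ 29 ∷ 32 ∷ 34 ∷ 35 ∷ 37 ∷ 39 ∷ 40 ∷ [])
    ∷ (1 ∷ 2 ∷ 5 ∷ 6 ∷ 7 ∷ 9 ∷ 10 ∷ 14 ∷ 17 ∷ 18 ∷ 19 ∷ 22 ∷ 24 ∷ 25 ∷ 27 ∷ 32 ∷ 33 ∷ 35 ∷ 37 ∷ 39 ∷ [])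
    ∷ (0 ∷ 1 ∷ 4 ∷ 5 ∷ 9 ∷ 10 ∷ 12 ∷ 13 ∷ 14 ∷ 18 ∷ 21 ∷ 22 ∷ 23 ∷ 25 ∷ 27 ∷ 31 ∷ 35 ∷ 36 ∷ 38 ∷ 40 ∷ [])
    ∷ (0 ∷ 3 ∷ 4 ∷ 6 ∷ 7 ∷ 8 ∷ 9 ∷ 10 ∷ 12 ∷ 21 ∷ 23 ∷ 24 ∷ 31 ∷ 32 ∷ 33 ∷ 34 ∷ 35 ∷ 36 ∷ 37 ∷ 39 ∷ [])
    ∷ (1 ∷ 4 ∷ 5 ∷ 7 ∷ 8 ∷ 9 ∷ 11 ∷ 13 ∷ 16 ∷ 17 ∷ 18 ∷ 20 ∷ 22 ∷ 23 ∷ 29 ∷ 30 ∷ 33 ∷ 34 ∷ 35 ∷ 39 ∷ [])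
    ∷ (0 ∷ 1 ∷ 3 ∷ 4 ∷ 7 ∷ 10 ∷ 11 ∷ 15 ∷ 17 ∷ 18 ∷ 22 ∷ 23 ∷ 24 ∷ 26 ∷ 27 ∷ 28 ∷ 30 ∷ 33 ∷ 36 ∷ 40 ∷ [])
    ∷ (1 ∷ 2 ∷ 4 ∷ 5 ∷ 6 ∷ 8 ∷ 10 ∷ 11 ∷ 12 ∷ 13 ∷ 17 ∷ 19 ∷ 28 ∷ 30 ∷ 31 ∷ 32 ∷ 36 ∷ 38 ∷ 39 ∷ 40 ∷ [])
    ∷ (0 ∷ 2 ∷ 4 ∷ 6 ∷ 7 ∷ 12 ∷ 14 ∷ 15 ∷ 17 ∷ 18 ∷ 19 ∷ 20 ∷ 23 ∷ 26 ∷ 27 ∷ 30 ∷ 31 ∷ 35 ∷ 38 ∷ 39 ∷ [])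
    ∷ (1 ∷ 3 ∷ 5 ∷ 7 ∷ 8 ∷ 10 ∷ 15 ∷ 17 ∷ 19 ∷ 21 ∷ 23 ∷ 25 ∷ 27 ∷ 28 ∷ 29 ∷ 30 ∷ 31 ∷ 34 ∷ 37 ∷ 38 ∷ [])
    ∷ (0 ∷ 1 ∷ 3 ∷ 5 ∷ 7 ∷ 12 ∷ 13 ∷ 14 ∷ 15 ∷ 16 ∷ 18 ∷ 19 ∷ 21 ∷ 24 ∷ 29 ∷ 30 ∷ 32 ∷ 33 ∷ 38 ∷ 39 ∷ [])
    ∷ (0 ∷ 3 ∷ 5 ∷ 6 ∷ 7 ∷ 9 ∷ 11 ∷ 12 ∷ 13 ∷ 16 ∷ 17 ∷ 21 ∷ 25 ∷ 26 ∷ 27 ∷ 28 ∷ 30 ∷ 35 ∷ 39 ∷ 40 ∷ [])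
    ∷ (0 ∷ 2 ∷ 3 ∷ 5 ∷ 6 ∷ 9 ∷ 10 ∷ 11 ∷ 15 ∷ 17 ∷ 18 ∷ 19 ∷ 20 ∷ 21 ∷ 29 ∷ 33 ∷ 34 ∷ 35 ∷ 36 ∷ 40 ∷ [])
    ∷ (0 ∷ 2 ∷ 5 ∷ 8 ∷ 9 ∷ 10 ∷ 13 ∷ 14 ∷ 15 ∷ 16 ∷ 18 ∷ 26 ∷ 27 ∷ 28 ∷ 30 ∷ 31 ∷ 33 ∷ 34 ∷ 36 ∷ 37 ∷ [])
    ∷ (0 ∷ 2 ∷ 4 ∷ 5 ∷ 7 ∷ 8 ∷ 10 ∷ 12 ∷ 16 ∷ 17 ∷ 20 ∷ 21 ∷ 22 ∷ 26 ∷ 27 ∷ 29 ∷ 32 ∷ 33 ∷ 37 ∷ 38 ∷ [])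
    ∷ [])

  QR₂₉ : ConnSet 29
  QR₂₉ = paley 29 refl refl

  QR₃₇ : ConnSet 37
  QR₃₇ = paley 37 refl refl

  QR₄₁ : ConnSet 41
  QR₄₁ = paley 41 refl refl

  Γ₂₉ : Graph 29
  Γ₂₉ = graph (fromNeighbours neighbours₂₉) refl

  Γ₃₇ : Graph 37
  Γ₃₇ = graph (fromNeighbours neighbours₃₇) refl

  Γ₄₁ : Graph 41
  Γ₄₁ = graph (fromNeighbours neighbours₄₁) refl

  cospectral₂₉ : Cospectral (Cay 29 QR₂₉) (adj Γ₂₉)
  cospectral₂₉ = cospectral-by-sampling (Cay 29 QR₂₉) (adj Γ₂₉) refl

  cospectral₃₇ : Cospectral (Cay 37 QR₃₇) (adj Γ₃₇)
  cospectral₃₇ = cospectral-by-sampling (Cay 37 QR₃₇) (adj Γ₃₇) refl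

  cospectral₄₁ : Cospectral (Cay 41 QR₄₁) (adj Γ₄₁)
  cospectral₄₁ = cospectral-by-sampling (Cay 41 QR₄₁) (adj Γ₄₁) refl

open PaleyGraphs

proposition3p1 : ¬ IsDS 29 × ¬ IsDS 37 × ¬ IsDS 41
proposition3p1 =
  ¬IsDS-by-pattern QR₂₉ Γ₂₉ K₅  cospectral₂₉ refl refl ,
  ¬IsDS-by-pattern QR₃₇ Γ₃₇ K₅  cospectral₃₇ refl refl ,
  ¬IsDS-by-pattern QR₄₁ Γ₄₁ K₆⁻ cospectral₄₁ refl refl
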